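{- Let $V\subset\mathbb{P}^n$ be a hypersurface over $\mathbb{Q}$ of degree $n+1$ defined by $f=0$, and suppose that for some $k$ with $2\le k\le n$ and indices $0\le i_1<\dots<i_k\le n$ we have $f\in(x_{i_1},\dots,x_{i_k})^k$. Let $L(V,k)$ be the exceptional divisor of the blowup of $V$ along the linear subspace $x_{i_1}=\dots=x_{i_k}=0$ (naturally a hypersurface of bidegree $(n-k+1,k)$ in $\mathbb{P}^{n-k}\times\mathbb{P}^{k-1}$). Then $L(V,k)$ is prime-similar to $V$.
   Context: For a projective variety $X$ over $\mathbb{Q}$ and a prime $p$, $[X]_p$ denotes the number of $\mathbb{F}_p$-points of its reduction mod $p$. Projective varieties $V,W$ over $\mathbb{Q}$ are prime-similar if $[V]_p-1\equiv(-1)^{\dim W-\dim V}([W]_p-1)\pmod p$ for all but finitely many primes $p$. -}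

module Defs where

open import Function using (_∘_)
open import Data.Nat as ℕ using (ℕ; zero; suc; _≤_; _<_; _∸_)
open import Data.Nat.Primality using (Prime)
import Data.Nat.ListAction as ℕLA
open import Data.Nat.Divisibility using (_∣?_)
open import Data.Integer as ℤ using (ℤ; +_; ∣_∣)
open import Data.Integer.Divisibility as ℤD using ()
open import Data.Bool using (Bool; true; false; if_then_else_; _∧_; not)
open import Data.List as L using (List; []; _∷_)
open import Data.Vec as V using (Vec)
open import Data.Fin using (Fin)
open import Data.Product using (∃; Σ; _×_)
open import Relation.Nullary.Decidable using (⌊_⌋)
open import Relation.Binary.PropositionalEquality using (_≡_; _≢_)

-- All vectors of length m with entries in {0, …, p-1} (i.e. F_p^m).
vecs : ℕ → (m : ℕ) → List (Vec ℕ m)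
vecs p zero    = V.[] ∷ []
vecs p (suc m) = L.concatMap (λ a → L.map (a V.∷_) (vecs p m)) (L.upTo p)

monomials : (d m : ℕ) → List (Vec ℕ m)
monomials d m = L.filter (λ e → V.sum e ℕ.≟ d) (vecs (suc d) m)

-- A homogeneous form of degree d in m variables with integer coefficients
-- is given by its coefficient function on exponent vectors; only exponent
-- vectors of total degree d are used (see evalForm).
Coeffs : ℕ → Set
Coeffs m = Vec ℕ m → ℤ

monoVal : ∀ {m} → Vec ℕ m → Vec ℕ m → ℕ
monoVal x e = ℕLA.product (V.toList (V.zipWith ℕ._^_ x e))

evalForm : ∀ {m} → (d : ℕ) → Coeffs m → Vec ℕ m → ℤ
evalForm {m} d c x = L.foldr (λ e acc → c e ℤ.* (+ monoVal x e) ℤ.+ acc) (+ 0) (monomials d m)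

ideg : ∀ {m} → (Fin m → Bool) → Vec ℕ m → ℕ
ideg I e = V.sum (V.tabulate (λ i → if I i then V.lookup e i else 0))

card : ∀ {m} → (Fin m → Bool) → ℕ
card {m} I = L.length (L.filterᵇ I (L.allFin m))

NonzeroForm : ∀ {m} → ℕ → Coeffs m → Set
NonzeroForm {m} d c = Σ (Vec ℕ m) (λ e → V.sum e ≡ d × c e ≢ + 0)

-- f ∈ (x_i : I i)^k for the degree-d form f: every monomial of f with
-- nonzero coefficient has degree ≥ k in the variables indexed by I.
InIdealPower : ∀ {m} → ℕ → (Fin m → Bool) → ℕ → Coeffs m → Set
InIdealPower {m} d I k c = ∀ (e : Vec ℕ m) → V.sum e ≡ d → ideg I e < k → c e ≡ + 0

-- The equation of the exceptional divisor L(V,k): writing y for the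
-- variables outside I (coordinates of P^{n-k}) and t for the variables in
-- I (coordinates of P^{k-1}), f_k(y,t) = Σ_{|e|=d, I-degree(e)=k} c(e) y^{e_J} t^{e_I},
-- i.e. the lowest-order part of f along x_I = 0, of bidegree (d-k, k).
evalExc : ∀ {m} → (d k : ℕ) → (Fin m → Bool) → Coeffs m → Vec ℕ m → ℤ
evalExc {m} d k I c x =
  L.foldr (λ e acc → c e ℤ.* (+ monoVal x e) ℤ.+ acc) (+ 0)
          (L.filter (λ e → ideg I e ℕ.≟ k) (monomials d m))

-- Normalised representative of a projective point: not all zero, and the
-- first nonzero coordinate equals 1.
normalized : List ℕ → Bool
normalized []              = false
normalized (0 ∷ xs)        = normalized xs
normalized (1 ∷ xs)        = true
normalized (suc (suc _) ∷ xs) = false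

select : ∀ {m} → (Fin m → Bool) → Vec ℕ m → List ℕ
select {m} I x = L.concatMap (λ i → if I i then V.lookup x i ∷ [] else []) (L.allFin m)

divisibleBy : ℕ → ℤ → Bool
divisibleBy p v = ⌊ p ∣? ∣ v ∣ ⌋

-- [V]_p for V = {f = 0} ⊂ P^n, f a degree-d form in n+1 variables:
-- number of F_p-points of P^n where f vanishes mod p.
countHyp : (n d : ℕ) → Coeffs (suc n) → ℕ → ℕ
countHyp n d c p =
  L.length (L.filterᵇ (λ x → normalized (V.toList x) ∧ divisibleBy p (evalForm d c x))
                      (vecs p (suc n)))

-- [L(V,k)]_p: number of F_p-points (y,t) of P(J) × P(I) = P^{n-k} × P^{k-1}
-- (J = complement of I) where f_k vanishes mod p.
countExc : (n d k : ℕ) → (Fin (suc n) → Bool) → Coeffs (suc n) → ℕ → ℕ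
countExc n d k I c p =
  L.length (L.filterᵇ (λ x → normalized (select I x) ∧ normalized (select (not ∘ I) x)
                               ∧ divisibleBy p (evalExc d k I c x))
                      (vecs p (suc n)))

signDiff : ℕ → ℕ → ℤ
signDiff a b = ℤ.- (+ 1) ℤ.^ ∣ (+ a) ℤ.- (+ b) ∣

-- X (dimension dX, point counts cX) and Y (dimension dY, point counts cY) are
-- prime-similar: for all but finitely many primes p (all primes p ≥ N),
-- [X]_p - 1 ≡ (-1)^{dim Y - dim X} ([Y]_p - 1) (mod p).
PrimeSimilar : ℕ → (ℕ → ℕ) → ℕ → (ℕ → ℕ) → Set
PrimeSimilar dX cX dY cY =
  ∃ λ (N : ℕ) → ∀ (p : ℕ) → Prime p → N ≤ p →
    (+ p) ℤD.∣ ((+ cX p ℤ.- + 1) ℤ.- signDiff dY dX ℤ.* (+ cY p ℤ.- + 1))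

-- Count affine zeros over 𝔽_p. For a form h in m variables, the number N(h) of zeros of h in 𝔽_p^m satisfies
-- N(h) ≡ -Σ_x h(x)^(p-1) (mod p). Let f_k be the part of f of degree exactly k in x_I; it cuts out L(V,k).
-- Since f ∈ (x_I)^k, f and f_k have degree ≤ n-k+1 in the n-k+1 remaining variables x_J, and f - f_k has
-- degree ≤ n-k there, so a Chevalley–Warning argument in x_J gives Σ f^(p-1) ≡ Σ f_k^(p-1), i.e. N(f) ≡ N(f_k).
-- Counting orbits of the units, N(f) = 1 + (p-1)[V]_p and, splitting by whether x_I or x_J vanishes,
-- N(f_k) = p^(n-k+1) + (p^k - 1) + (p-1)²[L(V,k)]_p. Reducing mod p: 1 - [V]_p ≡ [L(V,k)]_p - 1.

module Submission where

open import Defs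
open import Algebra.Bundles using (CommutativeSemiring; CommutativeMonoid)
open import Data.Bool using (Bool; true; false; if_then_else_; _∧_; not)
import Data.Bool.ListAction as BL
import Data.Bool.Properties as BP
open import Data.Empty using (⊥-elim)
open import Data.Fin using (Fin; zero; suc; toℕ; inject₁; fromℕ)
import Data.Fin.Properties as FP
open import Data.Integer as ℤ using (ℤ; +_; ∣_∣)
import Data.Integer.DivMod as ℤDM
import Data.Integer.Properties as ℤP
open import Data.Integer.Divisibility.Signed as ℤD using (divides)
import Data.Integer.Solver as ℤSolver
open import Data.List as L using (List; []; _∷_; _++_)
import Data.List.Properties as LP
open import Data.List.Relation.Unary.All as All using (All; []; _∷_)
import Data.List.Relation.Unary.All.Properties as AllP
open import Data.Nat as ℕ using (ℕ; zero; suc; _≤_; _<_; _∸_; z≤n; s≤s; _^_; _!)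
open import Data.Nat.Combinatorics using (_C_; nCk≡n!/k![n-k]!; k![n∸k]!∣n!; nCn≡1)
import Data.Nat.DivMod as ℕDM
open import Data.Nat.Divisibility as ℕD using (_∣_; _∣?_)
open import Data.Nat.Induction using (<-rec)
open import Data.Nat.Primality using (Prime; euclidsLemma)
import Data.Nat.Properties as ℕP
import Data.Nat.Solver as ℕSolver
open import Data.Product using (Σ; _×_; _,_)
open import Data.Sum using (_⊎_; inj₁; inj₂)
open import Data.Vec as V using (Vec)
import Data.Vec.Properties as VP
import Data.Vec.Relation.Unary.All as VAll
open import Function using (_∘_; id)
open import Function.Bundles using (mk⇔)
open import Relation.Binary.Bundles using (Setoid)
open import Relation.Binary.Definitions using (DecidableEquality)
import Relation.Binary.PropositionalEquality as ≡
import Relation.Binary.Reasoning.Setoid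
open import Relation.Binary.Structures using (IsEquivalence)
open import Relation.Nullary using (Dec; yes; no; ¬_; does)
open import Relation.Nullary.Decidable using (isYes; isYes≗does; does-⇔; dec-true)

import Algebra.Properties.CommutativeSemiring.Binomial ℕP.+-*-commutativeSemiring as Binomial
import Algebra.Properties.Semiring.Exp ℕP.+-*-semiring as Exp
import Algebra.Properties.Semiring.Mult ℕP.+-*-semiring as Mult
import Algebra.Properties.Semiring.Sum ℕP.+-*-semiring as FinSum
import Algebra.Properties.CommutativeSemigroup ℕP.+-commutativeSemigroup as ℕ+
import Algebra.Properties.CommutativeSemigroup ℕP.*-commutativeSemigroup as ℕ*
import Algebra.Properties.CommutativeSemigroup ℤP.*-commutativeSemigroup as ℤ*
import Algebra.Properties.CommutativeSemigroup (CommutativeMonoid.commutativeSemigroup BP.∧-commutativeMonoid) as ∧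

module ListSum {c ℓ} (R : CommutativeSemiring c ℓ) where
  open CommutativeSemiring R
  open import Algebra.Properties.CommutativeSemigroup +-commutativeSemigroup using (interchange)
  open import Relation.Binary.Reasoning.Setoid setoid

  ∑ : {A : Set} → List A → (A → Carrier) → Carrier
  ∑ []       f = 0#
  ∑ (x ∷ xs) f = f x + ∑ xs f

  module _ {A : Set} where

    ∑-++ : ∀ (xs ys : List A) f → ∑ (xs ++ ys) f ≈ ∑ xs f + ∑ ys f
    ∑-++ []       ys f = sym (+-identityˡ _)
    ∑-++ (x ∷ xs) ys f = trans (+-congˡ (∑-++ xs ys f)) (sym (+-assoc _ _ _))

    ∑-congᴬ : ∀ {P : A → Set} (xs : List A) {f g} → All P xs → (∀ x → P x → f x ≈ g x) → ∑ xs f ≈ ∑ xs g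
    ∑-congᴬ []       []         e = refl
    ∑-congᴬ (x ∷ xs) (px ∷ pxs) e = +-cong (e x px) (∑-congᴬ xs pxs e)

    ∑-cong : ∀ (xs : List A) {f g} → (∀ x → f x ≈ g x) → ∑ xs f ≈ ∑ xs g
    ∑-cong []       e = refl
    ∑-cong (x ∷ xs) e = +-cong (e x) (∑-cong xs e)

    ∑-zero : ∀ (xs : List A) → ∑ xs (λ _ → 0#) ≈ 0#
    ∑-zero []       = refl
    ∑-zero (x ∷ xs) = trans (+-identityˡ _) (∑-zero xs)

    ∑-+ : ∀ (xs : List A) f g → ∑ xs (λ x → f x + g x) ≈ ∑ xs f + ∑ xs g
    ∑-+ []       f g = sym (+-identityˡ _)
    ∑-+ (x ∷ xs) f g = trans (+-congˡ (∑-+ xs f g)) (interchange _ _ _ _)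

    ∑-*ˡ : ∀ c (xs : List A) f → ∑ xs (λ x → c * f x) ≈ c * ∑ xs f
    ∑-*ˡ c []       f = sym (zeroʳ c)
    ∑-*ˡ c (x ∷ xs) f = trans (+-congˡ (∑-*ˡ c xs f)) (sym (distribˡ c _ _))

    ∑-*ʳ : ∀ c (xs : List A) f → ∑ xs (λ x → f x * c) ≈ ∑ xs f * c
    ∑-*ʳ c xs f = begin
      ∑ xs (λ x → f x * c) ≈⟨ ∑-cong xs (λ x → *-comm (f x) c) ⟩
      ∑ xs (λ x → c * f x) ≈⟨ ∑-*ˡ c xs f ⟩
      c * ∑ xs f           ≈⟨ *-comm c _ ⟩
      ∑ xs f * c           ∎

  ∑-map : ∀ {A B : Set} (g : A → B) (xs : List A) f → ∑ (L.map g xs) f ≈ ∑ xs (f ∘ g)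
  ∑-map g []       f = refl
  ∑-map g (x ∷ xs) f = +-congˡ (∑-map g xs f)

  ∑-concatMap : ∀ {A B : Set} (g : A → List B) (xs : List A) f →
                ∑ (L.concatMap g xs) f ≈ ∑ xs (λ a → ∑ (g a) f)
  ∑-concatMap g []       f = refl
  ∑-concatMap g (x ∷ xs) f = trans (∑-++ (g x) _ f) (+-congˡ (∑-concatMap g xs f))

  ∑-comm : ∀ {A B : Set} (xs : List A) (ys : List B) (f : A → B → Carrier) →
           ∑ xs (λ x → ∑ ys (f x)) ≈ ∑ ys (λ y → ∑ xs (λ x → f x y))
  ∑-comm []       ys f = sym (∑-zero ys)
  ∑-comm (x ∷ xs) ys f = trans (+-congˡ (∑-comm xs ys f)) (sym (∑-+ ys (f x) _))

open ListSum ℕP.+-*-commutativeSemiring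
open ≡ using (_≡_; refl; sym; trans; cong; cong₂; subst; module ≡-Reasoning)

𝟙 : Bool → ℕ
𝟙 b = if b then 1 else 0

count≡∑𝟙 : ∀ {A : Set} (P : A → Bool) xs → L.length (L.filterᵇ P xs) ≡ ∑ xs (𝟙 ∘ P)
count≡∑𝟙 P []       = refl
count≡∑𝟙 P (x ∷ xs) with P x
... | true  = cong suc (count≡∑𝟙 P xs)
... | false = count≡∑𝟙 P xs

∑-const : ∀ {A : Set} (xs : List A) c → ∑ xs (λ _ → c) ≡ L.length xs ℕ.* c
∑-const []       c = refl
∑-const (x ∷ xs) c = cong (c ℕ.+_) (∑-const xs c)

𝟙-∧ : ∀ a b → 𝟙 (a ∧ b) ≡ 𝟙 a ℕ.* 𝟙 b
𝟙-∧ true  b = sym (ℕP.+-identityʳ (𝟙 b))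
𝟙-∧ false b = refl

∑-𝟙-split : ∀ {A : Set} (xs : List A) (P Q : A → Bool) →
            ∑ xs (𝟙 ∘ P) ≡ ∑ xs (λ x → 𝟙 (P x ∧ Q x)) ℕ.+ ∑ xs (λ x → 𝟙 (P x ∧ not (Q x)))
∑-𝟙-split xs P Q = trans (∑-cong xs (λ x → split (P x) (Q x))) (∑-+ xs _ _)
  where
  split : ∀ b c → 𝟙 b ≡ 𝟙 (b ∧ c) ℕ.+ 𝟙 (b ∧ not c)
  split true  true  = refl
  split true  false = refl
  split false c     = refl

𝟙-∧-implied : ∀ b c → (c ≡ true → b ≡ true) → 𝟙 (b ∧ c) ≡ 𝟙 c
𝟙-∧-implied b true  c⇒b rewrite c⇒b refl = refl
𝟙-∧-implied b false c⇒b = cong 𝟙 (BP.∧-zeroʳ b)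

module ℤ∑ = ListSum ℤP.+-*-commutativeSemiring

ℤ∑-− : ∀ {A : Set} (xs : List A) f g → ℤ∑.∑ xs (λ x → f x ℤ.- g x) ≡ ℤ∑.∑ xs f ℤ.- ℤ∑.∑ xs g
ℤ∑-− []       f g = refl
ℤ∑-− (x ∷ xs) f g = begin
    f x ℤ.- g x ℤ.+ ℤ∑.∑ xs (λ x → f x ℤ.- g x)
  ≡⟨ cong (λ s → f x ℤ.- g x ℤ.+ s) (ℤ∑-− xs f g) ⟩
    f x ℤ.- g x ℤ.+ (ℤ∑.∑ xs f ℤ.- ℤ∑.∑ xs g)
  ≡⟨ solve 4 (λ a b c d → a :- b :+ (c :- d) := a :+ c :- (b :+ d)) refl (f x) (g x) _ _ ⟩
    f x ℤ.+ ℤ∑.∑ xs f ℤ.- (g x ℤ.+ ℤ∑.∑ xs g) ∎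
  where
  open ≡-Reasoning
  open ℤSolver.+-*-Solver

+-∑ : ∀ {A : Set} (xs : List A) (f : A → ℕ) → + ∑ xs f ≡ ℤ∑.∑ xs (λ x → + f x)
+-∑ []       f = refl
+-∑ (x ∷ xs) f = trans (ℤP.pos-+ (f x) _) (cong (λ s → + f x ℤ.+ s) (+-∑ xs f))

+-^ : ∀ a n → + (a ^ n) ≡ (+ a) ℤ.^ n
+-^ a zero    = refl
+-^ a (suc n) = trans (ℤP.pos-* a (a ^ n)) (cong (+ a ℤ.*_) (+-^ a n))

module Congruence (p : ℕ) where
  open ℤSolver.+-*-Solver

  infix 4 _≋_
  record _≋_ (a b : ℤ) : Set where
    constructor mk
    field divides-difference : + p ℤD.∣ a ℤ.- b
  open _≋_ public

  private
    transport : ∀ {a b} → a ≡ b → + p ℤD.∣ a → + p ℤD.∣ b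
    transport e = subst (+ p ℤD.∣_) e

  ≋-reflexive : ∀ {a b} → a ≡ b → a ≋ b
  ≋-reflexive {a} refl = mk (divides (+ 0) (ℤP.+-inverseʳ a))

  ≋-refl : ∀ {a} → a ≋ a
  ≋-refl = ≋-reflexive refl

  ≋-sym : ∀ {a b} → a ≋ b → b ≋ a
  ≋-sym {a} {b} (mk d) = mk (transport (solve 2 (λ a b → :- (a :- b) := b :- a) refl a b) (ℤD.∣m⇒∣-m d))

  ≋-trans : ∀ {a b c} → a ≋ b → b ≋ c → a ≋ c
  ≋-trans {a} {b} {c} (mk d) (mk e) =
    mk (transport (solve 3 (λ a b c → a :- b :+ (b :- c) := a :- c) refl a b c) (ℤD.∣m∣n⇒∣m+n d e))

  ≋-isEquivalence : IsEquivalence _≋_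
  ≋-isEquivalence = record { refl = ≋-refl ; sym = ≋-sym ; trans = ≋-trans }

  ≋-setoid : Setoid _ _
  ≋-setoid = record { isEquivalence = ≋-isEquivalence }

  module ≋-Reasoning = Relation.Binary.Reasoning.Setoid ≋-setoid

  ≋-+ : ∀ {a b c d} → a ≋ b → c ≋ d → a ℤ.+ c ≋ b ℤ.+ d
  ≋-+ {a} {b} {c} {d} (mk x) (mk y) =
    mk (transport (solve 4 (λ a b c d → a :- b :+ (c :- d) := a :+ c :- (b :+ d)) refl a b c d) (ℤD.∣m∣n⇒∣m+n x y))

  ≋-neg : ∀ {a b} → a ≋ b → ℤ.- a ≋ ℤ.- b
  ≋-neg {a} {b} (mk x) = mk (transport (solve 2 (λ a b → :- (a :- b) := :- a :- :- b) refl a b) (ℤD.∣m⇒∣-m x))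

  ≋-− : ∀ {a b c d} → a ≋ b → c ≋ d → a ℤ.- c ≋ b ℤ.- d
  ≋-− x y = ≋-+ x (≋-neg y)

  ≋-* : ∀ {a b c d} → a ≋ b → c ≋ d → a ℤ.* c ≋ b ℤ.* d
  ≋-* {a} {b} {c} {d} (mk x) (mk y) =
    mk (transport (solve 4 (λ a b c d → c :* (a :- b) :+ b :* (c :- d) := a :* c :- b :* d) refl a b c d)
                  (ℤD.∣m∣n⇒∣m+n (ℤD.∣n⇒∣m*n c x) (ℤD.∣n⇒∣m*n b y)))

  ≋-^ : ∀ {a b} n → a ≋ b → a ℤ.^ n ≋ b ℤ.^ n
  ≋-^ zero    x = ≋-refl
  ≋-^ (suc n) x = ≋-* x (≋-^ n x)

  ∣⇒≋0 : ∀ {a} → + p ℤD.∣ a → a ≋ + 0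
  ∣⇒≋0 {a} d = mk (transport (sym (ℤP.+-identityʳ a)) d)

  ≋0⇒∣ : ∀ {a} → a ≋ + 0 → + p ℤD.∣ a
  ≋0⇒∣ {a} (mk d) = transport (ℤP.+-identityʳ a) d

  ∣ℕ⇒≋0 : ∀ {a} → p ∣ a → + a ≋ + 0
  ∣ℕ⇒≋0 d = ∣⇒≋0 (ℤD.∣ᵤ⇒∣ d)

  ℤ∑-≋ : ∀ {A : Set} (xs : List A) {f g} → (∀ x → f x ≋ g x) → ℤ∑.∑ xs f ≋ ℤ∑.∑ xs g
  ℤ∑-≋ []       e = ≋-refl
  ℤ∑-≋ (x ∷ xs) e = ≋-+ (e x) (ℤ∑-≋ xs e)

*-^ : ∀ (a b : ℤ) n → (a ℤ.* b) ℤ.^ n ≡ a ℤ.^ n ℤ.* b ℤ.^ n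
*-^ a b zero    = refl
*-^ a b (suc n) = trans (cong (a ℤ.* b ℤ.*_) (*-^ a b n)) (solve 4 (λ a b x y → a :* b :* (x :* y) := a :* x :* (b :* y)) refl a b (a ℤ.^ n) (b ℤ.^ n))
  where open ℤSolver.+-*-Solver

divisibleBy-⇔ : ∀ p {v′ v} → (p ∣ ∣ v′ ∣ → p ∣ ∣ v ∣) → (p ∣ ∣ v ∣ → p ∣ ∣ v′ ∣) → divisibleBy p v′ ≡ divisibleBy p v
divisibleBy-⇔ p {v′} {v} to from = begin
    isYes (p ∣? ∣ v′ ∣)   ≡⟨ isYes≗does (p ∣? ∣ v′ ∣) ⟩
    does (p ∣? ∣ v′ ∣)    ≡⟨ does-⇔ (mk⇔ to from) (p ∣? ∣ v′ ∣) (p ∣? ∣ v ∣) ⟩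
    does (p ∣? ∣ v ∣)     ≡⟨ isYes≗does (p ∣? ∣ v ∣) ⟨
    isYes (p ∣? ∣ v ∣)    ∎
  where open ≡-Reasoning

module Multiplicity {A : Set} (_≟_ : DecidableEquality A) where

  δ : A → A → ℕ
  δ x y = 𝟙 (does (x ≟ y))

  δ-≡ : ∀ {x y} → x ≡ y → δ x y ≡ 1
  δ-≡ {x} {y} x≡y with x ≟ y
  ... | yes _   = refl
  ... | no  x≢y = ⊥-elim (x≢y x≡y)

  δ-≢ : ∀ {x y} → ¬ x ≡ y → δ x y ≡ 0
  δ-≢ {x} {y} x≢y with x ≟ y
  ... | yes x≡y = ⊥-elim (x≢y x≡y)
  ... | no  _   = refl

  δ-cong : ∀ {a b c d} → (a ≡ b → c ≡ d) → (c ≡ d → a ≡ b) → δ a b ≡ δ c d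
  δ-cong {a} {b} to from with a ≟ b
  ... | yes a≡b = sym (δ-≡ (to a≡b))
  ... | no  a≢b = sym (δ-≢ (a≢b ∘ from))

  multiplicity : List A → A → ℕ
  multiplicity xs y = ∑ xs (λ x → δ x y)

  ∑-δ : ∀ xs c (G : A → ℕ) → ∑ xs (λ y → δ y c ℕ.* G y) ≡ multiplicity xs c ℕ.* G c
  ∑-δ []       c G = refl
  ∑-δ (y ∷ xs) c G with y ≟ c
  ... | yes refl = cong₂ ℕ._+_ (ℕP.+-identityʳ (G y)) (∑-δ xs c G)
  ... | no  _    = ∑-δ xs c G

  multiplicity-∉ : ∀ xs c → All (λ x → ¬ x ≡ c) xs → multiplicity xs c ≡ 0
  multiplicity-∉ []       c []         = refl
  multiplicity-∉ (x ∷ xs) c (x≢c ∷ as) = trans (cong (ℕ._+ multiplicity xs c) (δ-≢ x≢c)) (multiplicity-∉ xs c as)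

  record Enumerates (R : A → Set) (xs : List A) : Set where
    field
      all    : All R xs
      unique : ∀ y → R y → multiplicity xs y ≡ 1
  open Enumerates public

  module _ {R : A → Set} {xs : List A} (enum : Enumerates R xs) where

    ∑-pick : ∀ c (G : A → ℕ) → R c → ∑ xs (λ y → δ y c ℕ.* G y) ≡ G c
    ∑-pick c G Rc = trans (∑-δ xs c G) (trans (cong (ℕ._* G c) (unique enum c Rc)) (ℕP.*-identityˡ (G c)))

    ∑-reindex : (σ τ : A → A) → (∀ x → R x → R (σ x)) → (∀ x → R x → R (τ x)) →
                (∀ x → R x → τ (σ x) ≡ x) → (∀ y → R y → σ (τ y) ≡ y) →
                (G : A → ℕ) → ∑ xs (G ∘ σ) ≡ ∑ xs G
    ∑-reindex σ τ Rσ Rτ τσ στ G = begin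
        ∑ xs (G ∘ σ)
      ≡⟨ ∑-congᴬ xs (all enum) (λ x Rx → sym (∑-pick (σ x) G (Rσ x Rx))) ⟩
        ∑ xs (λ x → ∑ xs (λ y → δ y (σ x) ℕ.* G y))
      ≡⟨ ∑-comm xs xs (λ x y → δ y (σ x) ℕ.* G y) ⟩
        ∑ xs (λ y → ∑ xs (λ x → δ y (σ x) ℕ.* G y))
      ≡⟨ ∑-congᴬ xs (all enum) (λ y Ry → trans (∑-*ʳ (G y) xs (λ x → δ y (σ x))) (cong (ℕ._* G y) (preimage y Ry))) ⟩
        ∑ xs (λ y → 1 ℕ.* G y)
      ≡⟨ ∑-cong xs (λ y → ℕP.*-identityˡ (G y)) ⟩
        ∑ xs G ∎
      where
      open ≡-Reasoning
      preimage : ∀ y → R y → ∑ xs (λ x → δ y (σ x)) ≡ 1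
      preimage y Ry = trans (∑-congᴬ xs (all enum) (λ x Rx →
                        δ-cong (λ y≡σx → trans (sym (τσ x Rx)) (cong τ (sym y≡σx)))
                               (λ x≡τy → trans (sym (στ y Ry)) (cong σ (sym x≡τy)))))
                        (unique enum (τ y) (Rτ y Ry))

open Multiplicity ℕP._≟_ using () renaming (δ to δℕ; Enumerates to Enumeratesℕ)
module VecMultiplicity {m : ℕ} = Multiplicity {Vec ℕ m} (VP.≡-dec ℕP._≟_)

upTo-enumerates : ∀ p → Enumeratesℕ (_< p) (L.upTo p)
upTo-enumerates p = record { all = AllP.applyUpTo⁺₁ id p id ; unique = unique′ p }
  where
  open Multiplicity ℕP._≟_
  last : ∀ p c → multiplicity (L.upTo (suc p)) c ≡ multiplicity (L.upTo p) c ℕ.+ δ p c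
  last p c = trans (cong (λ l → multiplicity l c) (sym (LP.upTo-∷ʳ p)))
                   (trans (∑-++ (L.upTo p) L.[ p ] _) (cong (multiplicity (L.upTo p) c ℕ.+_) (ℕP.+-identityʳ _)))
  unique′ : ∀ p c → c < p → multiplicity (L.upTo p) c ≡ 1
  unique′ (suc p) c c<1+p with ℕP.m≤n⇒m<n∨m≡n (ℕP.≤-pred c<1+p)
  ... | inj₁ c<p  = trans (last p c) (cong₂ ℕ._+_ (unique′ p c c<p) (δ-≢ (λ p≡c → ℕP.<-irrefl (sym p≡c) c<p)))
  ... | inj₂ refl = trans (last c c) (cong₂ ℕ._+_
                      (multiplicity-∉ (L.upTo c) c (AllP.applyUpTo⁺₁ id c (λ x<c x≡c → ℕP.<-irrefl x≡c x<c)))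
                      (δ-≡ {c} refl))

∑-vecs-suc : ∀ p m (F : Vec ℕ (suc m) → ℕ) → ∑ (vecs p (suc m)) F ≡ ∑ (L.upTo p) (λ t → ∑ (vecs p m) (F ∘ (t V.∷_)))
∑-vecs-suc p m F = trans (∑-concatMap _ (L.upTo p) F) (∑-cong (L.upTo p) (λ t → ∑-map (t V.∷_) (vecs p m) F))

δ-∷ : ∀ {m} a b (x y : Vec ℕ m) → VecMultiplicity.δ (a V.∷ x) (b V.∷ y) ≡ δℕ a b ℕ.* VecMultiplicity.δ x y
δ-∷ a b x y = cases (a ℕP.≟ b) (VP.≡-dec ℕP._≟_ x y)
  where
  module V≟ = VecMultiplicity
  module ℕ≟ = Multiplicity ℕP._≟_
  cases : Dec (a ≡ b) → Dec (x ≡ y) → V≟.δ (a V.∷ x) (b V.∷ y) ≡ δℕ a b ℕ.* V≟.δ x y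
  cases (yes refl) (yes refl) = trans (V≟.δ-≡ {x = a V.∷ x} refl) (sym (cong₂ ℕ._*_ (ℕ≟.δ-≡ {a} refl) (V≟.δ-≡ {x = x} refl)))
  cases (yes refl) (no x≢y)   = trans (V≟.δ-≢ {x = a V.∷ x} {a V.∷ y} (x≢y ∘ VP.∷-injectiveʳ)) (sym (trans (cong (δℕ a b ℕ.*_) (V≟.δ-≢ x≢y)) (ℕP.*-zeroʳ (δℕ a b))))
  cases (no a≢b)   _          = trans (V≟.δ-≢ {x = a V.∷ x} {b V.∷ y} (a≢b ∘ VP.∷-injectiveˡ)) (sym (cong (ℕ._* V≟.δ x y) (ℕ≟.δ-≢ a≢b)))

vecs-enumerates : ∀ p m → VecMultiplicity.Enumerates (VAll.All (_< p)) (vecs p m)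
vecs-enumerates p m = record { all = all′ m ; unique = unique′ m }
  where
  open VecMultiplicity
  all′ : ∀ m → All (VAll.All (_< p)) (vecs p m)
  all′ zero    = VAll.[] ∷ []
  all′ (suc m) = AllP.concat⁺ (AllP.map⁺ (All.map (λ t<p → AllP.map⁺ (All.map (t<p VAll.∷_) (all′ m))) (Multiplicity.all (upTo-enumerates p))))
  unique′ : ∀ m (y : Vec ℕ m) → VAll.All (_< p) y → multiplicity (vecs p m) y ≡ 1
  unique′ zero    V.[]       VAll.[]           = refl
  unique′ (suc m) (b V.∷ y) (b<p VAll.∷ y<p) = begin
      ∑ (vecs p (suc m)) (λ x → δ x (b V.∷ y))
    ≡⟨ ∑-vecs-suc p m _ ⟩
      ∑ (L.upTo p) (λ a → ∑ (vecs p m) (λ x → δ (a V.∷ x) (b V.∷ y)))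
    ≡⟨ ∑-cong (L.upTo p) (λ a → trans (∑-cong (vecs p m) (λ x → δ-∷ a b x y)) (∑-*ˡ (δℕ a b) (vecs p m) _)) ⟩
      ∑ (L.upTo p) (λ a → δℕ a b ℕ.* multiplicity (vecs p m) y)
    ≡⟨ ∑-cong (L.upTo p) (λ a → trans (cong (δℕ a b ℕ.*_) (unique′ m y y<p)) (ℕP.*-identityʳ _)) ⟩
      ∑ (L.upTo p) (λ a → δℕ a b)
    ≡⟨ Multiplicity.unique (upTo-enumerates p) b b<p ⟩
      1 ∎
    where open ≡-Reasoning

data Poly₁< (b : ℕ) : (ℕ → ℕ) → Set where
  zeroᴾ : Poly₁< b (λ _ → 0)
  monoᴾ : (c j : ℕ) → j < b → Poly₁< b (λ t → c ℕ.* t ^ j)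
  _+ᴾ_  : ∀ {F G} → Poly₁< b F → Poly₁< b G → Poly₁< b (λ t → F t ℕ.+ G t)
  castᴾ : ∀ {F G} → Poly₁< b F → (∀ t → G t ≡ F t) → Poly₁< b G

Poly₁<-mono : ∀ {b b′ F} → b ≤ b′ → Poly₁< b F → Poly₁< b′ F
Poly₁<-mono le zeroᴾ           = zeroᴾ
Poly₁<-mono le (monoᴾ c j j<b) = monoᴾ c j (ℕP.<-≤-trans j<b le)
Poly₁<-mono le (P +ᴾ Q)        = Poly₁<-mono le P +ᴾ Poly₁<-mono le Q
Poly₁<-mono le (castᴾ P e)     = castᴾ (Poly₁<-mono le P) e

Poly₁<-*X : ∀ {b F} → Poly₁< b F → Poly₁< (suc b) (λ t → t ℕ.* F t)
Poly₁<-*X zeroᴾ           = castᴾ zeroᴾ ℕP.*-zeroʳ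
Poly₁<-*X (monoᴾ c j j<b) = castᴾ (monoᴾ c (suc j) (s≤s j<b)) (λ t → ℕ*.x∙yz≈y∙xz t c (t ^ j))
Poly₁<-*X (P +ᴾ Q)        = castᴾ (Poly₁<-*X P +ᴾ Poly₁<-*X Q) (λ t → ℕP.*-distribˡ-+ t _ _)
Poly₁<-*X (castᴾ P e)     = castᴾ (Poly₁<-*X P) (λ t → cong (t ℕ.*_) (e t))

suc-^-expansion : ∀ a → Σ (ℕ → ℕ) λ R → Poly₁< a R × (∀ t → suc t ^ suc a ≡ t ^ suc a ℕ.+ suc a ℕ.* t ^ a ℕ.+ R t)
suc-^-expansion zero    = (λ _ → 0) , zeroᴾ , λ t → solve 1 (λ t → (con 1 :+ t) :* con 1 := t :* con 1 :+ con 1 :* con 1 :+ con 0) refl t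
  where open ℕSolver.+-*-Solver
suc-^-expansion (suc a) with suc-^-expansion a
... | R , R<a , expand = R′ , R′<1+a , expand′
  where
  open ℕSolver.+-*-Solver
  R′ : ℕ → ℕ
  R′ t = suc a ℕ.* t ^ a ℕ.+ (t ℕ.* R t ℕ.+ R t)
  R′<1+a : Poly₁< (suc a) R′
  R′<1+a = monoᴾ (suc a) a ℕP.≤-refl +ᴾ (Poly₁<-*X R<a +ᴾ Poly₁<-mono (ℕP.n≤1+n a) R<a)
  expand′ : ∀ t → suc t ^ suc (suc a) ≡ t ^ suc (suc a) ℕ.+ suc (suc a) ℕ.* t ^ suc a ℕ.+ R′ t
  expand′ t = begin
      suc t ℕ.* suc t ^ suc a
    ≡⟨ cong (suc t ℕ.*_) (expand t) ⟩
      suc t ℕ.* (t ℕ.* t ^ a ℕ.+ suc a ℕ.* t ^ a ℕ.+ R t)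
    ≡⟨ solve 4 (λ t x a r → (con 1 :+ t) :* (t :* x :+ (con 1 :+ a) :* x :+ r)
                 := t :* (t :* x) :+ (con 1 :+ (con 1 :+ a)) :* (t :* x) :+ ((con 1 :+ a) :* x :+ (t :* r :+ r))) refl t (t ^ a) a (R t) ⟩
      t ℕ.* (t ℕ.* t ^ a) ℕ.+ suc (suc a) ℕ.* (t ℕ.* t ^ a) ℕ.+ R′ t ∎
    where open ≡-Reasoning

allFin-suc : ∀ m → L.allFin (suc m) ≡ zero ∷ L.map suc (L.allFin m)
allFin-suc m = cong (zero ∷_) (sym (LP.map-tabulate id suc))

card-suc : ∀ {m} (I : Fin (suc m) → Bool) → card I ≡ 𝟙 (I zero) ℕ.+ card (I ∘ suc)
card-suc {m} I = begin
    card I                                              ≡⟨ count≡∑𝟙 I (L.allFin (suc m)) ⟩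
    ∑ (L.allFin (suc m)) (𝟙 ∘ I)                        ≡⟨ cong (λ xs → ∑ xs (𝟙 ∘ I)) (allFin-suc m) ⟩
    𝟙 (I zero) ℕ.+ ∑ (L.map suc (L.allFin m)) (𝟙 ∘ I)   ≡⟨ cong (𝟙 (I zero) ℕ.+_) (∑-map suc (L.allFin m) (𝟙 ∘ I)) ⟩
    𝟙 (I zero) ℕ.+ ∑ (L.allFin m) (𝟙 ∘ I ∘ suc)         ≡⟨ cong (𝟙 (I zero) ℕ.+_) (count≡∑𝟙 (I ∘ suc) (L.allFin m)) ⟨
    𝟙 (I zero) ℕ.+ card (I ∘ suc)                       ∎
  where open ≡-Reasoning

card-compl : ∀ {m} (I : Fin m → Bool) → card I ℕ.+ card (not ∘ I) ≡ m
card-compl {zero}  I = refl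
card-compl {suc m} I rewrite card-suc I | card-suc (not ∘ I) with I zero
... | true  = cong suc (card-compl (I ∘ suc))
... | false = trans (ℕP.+-suc _ _) (cong suc (card-compl (I ∘ suc)))

entry : ∀ {m} → (Fin m → Bool) → Vec ℕ m → Fin m → List ℕ
entry I x i = if I i then V.lookup x i ∷ [] else []

select-∷ : ∀ {m} (I : Fin (suc m) → Bool) a (x : Vec ℕ m) →
           select I (a V.∷ x) ≡ entry I (a V.∷ x) zero ++ select (I ∘ suc) x
select-∷ {m} I a x = trans (cong (L.concatMap (entry I (a V.∷ x))) (allFin-suc m))
                           (cong (entry I (a V.∷ x) zero ++_) (LP.concatMap-map (entry I (a V.∷ x)) suc (L.allFin m)))

ideg-all : ∀ {m} (e : Vec ℕ m) → ideg (λ _ → true) e ≡ V.sum e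
ideg-all V.[]       = refl
ideg-all (a V.∷ e) = cong (a ℕ.+_) (ideg-all e)

ideg-compl : ∀ {m} (I : Fin m → Bool) (e : Vec ℕ m) → ideg I e ℕ.+ ideg (not ∘ I) e ≡ V.sum e
ideg-compl I V.[]       = refl
ideg-compl I (a V.∷ e) with I zero
... | true  = trans (ℕP.+-assoc a _ _) (cong (a ℕ.+_) (ideg-compl (I ∘ suc) e))
... | false = trans (ℕ+.x∙yz≈y∙xz (ideg (I ∘ suc) e) a _) (cong (a ℕ.+_) (ideg-compl (I ∘ suc) e))

monoVal-+ : ∀ {m} (x a b : Vec ℕ m) → monoVal x (V.zipWith ℕ._+_ a b) ≡ monoVal x a ℕ.* monoVal x b
monoVal-+ V.[]       V.[]        V.[]        = refl
monoVal-+ (t V.∷ x) (a V.∷ as) (b V.∷ bs) = begin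
    t ^ (a ℕ.+ b) ℕ.* monoVal x (V.zipWith ℕ._+_ as bs)
  ≡⟨ cong₂ ℕ._*_ (ℕP.^-distribˡ-+-* t a b) (monoVal-+ x as bs) ⟩
    t ^ a ℕ.* t ^ b ℕ.* (monoVal x as ℕ.* monoVal x bs)
  ≡⟨ ℕ*.interchange (t ^ a) (t ^ b) _ _ ⟩
    t ^ a ℕ.* monoVal x as ℕ.* (t ^ b ℕ.* monoVal x bs) ∎
  where open ≡-Reasoning

ideg-+ : ∀ {m} (J : Fin m → Bool) (a b : Vec ℕ m) → ideg J (V.zipWith ℕ._+_ a b) ≡ ideg J a ℕ.+ ideg J b
ideg-+ J V.[]        V.[]        = refl
ideg-+ J (a V.∷ as) (b V.∷ bs) with J zero
... | true  = trans (cong (a ℕ.+ b ℕ.+_) (ideg-+ (J ∘ suc) as bs)) (ℕ+.interchange a b _ _)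
... | false = ideg-+ (J ∘ suc) as bs

0ᵛ : ∀ {m} → Vec ℕ m
0ᵛ = V.replicate _ 0

monoVal-0ᵛ : ∀ {m} (x : Vec ℕ m) → monoVal x 0ᵛ ≡ 1
monoVal-0ᵛ V.[]       = refl
monoVal-0ᵛ (t V.∷ x) = trans (ℕP.*-identityˡ _) (monoVal-0ᵛ x)

ideg-0ᵛ : ∀ {m} (J : Fin m → Bool) → ideg J (0ᵛ {m}) ≡ 0
ideg-0ᵛ {zero}  J = refl
ideg-0ᵛ {suc m} J with J zero
... | true  = ideg-0ᵛ (J ∘ suc)
... | false = ideg-0ᵛ (J ∘ suc)

data Poly {m} (J : Fin m → Bool) (D : ℕ) : (Vec ℕ m → ℤ) → Set where
  zeroᴾ : Poly J D (λ _ → + 0)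
  monoᴾ : (c : ℤ) (a : Vec ℕ m) → ideg J a ≤ D → Poly J D (λ x → c ℤ.* + monoVal x a)
  _+ᴾ_  : ∀ {F G} → Poly J D F → Poly J D G → Poly J D (λ x → F x ℤ.+ G x)
  castᴾ : ∀ {F G} → Poly J D F → (∀ x → G x ≡ F x) → Poly J D G

module _ {m} {J : Fin m → Bool} where
  open ℤSolver.+-*-Solver

  Poly-mono : ∀ {A B F} → A ≤ B → Poly J A F → Poly J B F
  Poly-mono le zeroᴾ          = zeroᴾ
  Poly-mono le (monoᴾ c a a≤) = monoᴾ c a (ℕP.≤-trans a≤ le)
  Poly-mono le (P +ᴾ Q)       = Poly-mono le P +ᴾ Poly-mono le Q
  Poly-mono le (castᴾ P e)    = castᴾ (Poly-mono le P) e

  Poly-one : Poly J 0 (λ _ → + 1)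
  Poly-one = castᴾ (monoᴾ (+ 1) 0ᵛ (ℕP.≤-reflexive (ideg-0ᵛ J)))
                   (λ x → sym (trans (ℤP.*-identityˡ _) (cong +_ (monoVal-0ᵛ x))))

  private
    Poly-mono-* : ∀ {A B G} (c : ℤ) (a : Vec ℕ m) → ideg J a ≤ A → Poly J B G →
                  Poly J (A ℕ.+ B) (λ x → (c ℤ.* + monoVal x a) ℤ.* G x)
    Poly-mono-* c a a≤ zeroᴾ = castᴾ zeroᴾ (λ x → ℤP.*-zeroʳ (c ℤ.* + monoVal x a))
    Poly-mono-* c a a≤ (monoᴾ c′ b b≤) =
      castᴾ (monoᴾ (c ℤ.* c′) (V.zipWith ℕ._+_ a b) (subst (_≤ _) (sym (ideg-+ J a b)) (ℕP.+-mono-≤ a≤ b≤)))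
            (λ x → trans (solve 4 (λ c c′ u v → (c :* u) :* (c′ :* v) := (c :* c′) :* (u :* v)) refl c c′ (+ monoVal x a) (+ monoVal x b))
                         (cong ((c ℤ.* c′) ℤ.*_) (trans (sym (ℤP.pos-* (monoVal x a) (monoVal x b))) (cong +_ (sym (monoVal-+ x a b))))))
    Poly-mono-* c a a≤ (_+ᴾ_ {G₁} {G₂} P Q) =
      castᴾ (Poly-mono-* c a a≤ P +ᴾ Poly-mono-* c a a≤ Q) (λ x → ℤP.*-distribˡ-+ (c ℤ.* + monoVal x a) (G₁ x) (G₂ x))
    Poly-mono-* c a a≤ (castᴾ P e) = castᴾ (Poly-mono-* c a a≤ P) (λ x → cong ((c ℤ.* + monoVal x a) ℤ.*_) (e x))

  Poly-* : ∀ {A B F G} → Poly J A F → Poly J B G → Poly J (A ℕ.+ B) (λ x → F x ℤ.* G x)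
  Poly-* zeroᴾ Q = castᴾ zeroᴾ (λ x → refl)
  Poly-* (monoᴾ c a a≤) Q = Poly-mono-* c a a≤ Q
  Poly-* {G = G} (_+ᴾ_ {F₁} {F₂} P₁ P₂) Q = castᴾ (Poly-* P₁ Q +ᴾ Poly-* P₂ Q) (λ x → ℤP.*-distribʳ-+ (G x) (F₁ x) (F₂ x))
  Poly-* {G = G} (castᴾ P e) Q = castᴾ (Poly-* P Q) (λ x → cong (ℤ._* G x) (e x))

  Poly-^ : ∀ {D F} → Poly J D F → ∀ s → Poly J (D ℕ.* s) (λ x → F x ℤ.^ s)
  Poly-^ P zero          = Poly-mono z≤n Poly-one
  Poly-^ {D} P (suc s)   = Poly-mono (ℕP.≤-reflexive (sym (ℕP.*-suc D s))) (Poly-* P (Poly-^ P s))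

geom : ℕ → ℤ → ℤ → ℤ
geom zero    a b = + 1
geom (suc s) a b = a ℤ.^ suc s ℤ.+ b ℤ.* geom s a b

^-^-factor : ∀ s a b → a ℤ.^ suc s ℤ.- b ℤ.^ suc s ≡ (a ℤ.- b) ℤ.* geom s a b
^-^-factor zero    a b = solve 2 (λ a b → a :* con (+ 1) :- b :* con (+ 1) := (a :- b) :* con (+ 1)) refl a b
  where open ℤSolver.+-*-Solver
^-^-factor (suc s) a b = begin
    a ℤ.* a ℤ.^ suc s ℤ.- b ℤ.* b ℤ.^ suc s
  ≡⟨ solve 4 (λ a b x y → a :* x :- b :* y := (a :- b) :* x :+ b :* (x :- y)) refl a b (a ℤ.^ suc s) (b ℤ.^ suc s) ⟩
    (a ℤ.- b) ℤ.* a ℤ.^ suc s ℤ.+ b ℤ.* (a ℤ.^ suc s ℤ.- b ℤ.^ suc s)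
  ≡⟨ cong (λ z → (a ℤ.- b) ℤ.* a ℤ.^ suc s ℤ.+ b ℤ.* z) (^-^-factor s a b) ⟩
    (a ℤ.- b) ℤ.* a ℤ.^ suc s ℤ.+ b ℤ.* ((a ℤ.- b) ℤ.* geom s a b)
  ≡⟨ solve 4 (λ a b x g → (a :- b) :* x :+ b :* ((a :- b) :* g) := (a :- b) :* (x :+ b :* g)) refl a b (a ℤ.^ suc s) (geom s a b) ⟩
    (a ℤ.- b) ℤ.* geom (suc s) a b ∎
  where
  open ≡-Reasoning
  open ℤSolver.+-*-Solver

Poly-geom : ∀ {m} {J : Fin m → Bool} {D F G} → Poly J D F → Poly J D G → ∀ s → Poly J (D ℕ.* s) (λ x → geom s (F x) (G x))
Poly-geom     P Q zero    = Poly-mono z≤n Poly-one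
Poly-geom {D = D} P Q (suc s) = Poly-^ P (suc s) +ᴾ Poly-mono (ℕP.≤-reflexive (sym (ℕP.*-suc D s))) (Poly-* Q (Poly-geom P Q s))

isZero : List ℕ → Bool
isZero = BL.all (ℕ._≡ᵇ 0)

isZero-++ : ∀ xs ys → isZero (xs ++ ys) ≡ isZero xs ∧ isZero ys
isZero-++ []       ys = refl
isZero-++ (x ∷ xs) ys = trans (cong ((x ℕ.≡ᵇ 0) ∧_) (isZero-++ xs ys)) (sym (BP.∧-assoc (x ℕ.≡ᵇ 0) (isZero xs) (isZero ys)))

select-all : ∀ {m} (x : Vec ℕ m) → select (λ _ → true) x ≡ V.toList x
select-all V.[]       = refl
select-all (a V.∷ x) = trans (select-∷ (λ _ → true) a x) (cong (a ∷_) (select-all x))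

isZero-select-compl : ∀ {m} (T : Fin m → Bool) (x : Vec ℕ m) →
                      isZero (select T x) ∧ isZero (select (not ∘ T) x) ≡ isZero (V.toList x)
isZero-select-compl T V.[]       = refl
isZero-select-compl T (a V.∷ x) rewrite select-∷ T a x | select-∷ (not ∘ T) a x
  with T zero
... | true  = trans (BP.∧-assoc (a ℕ.≡ᵇ 0) _ _) (cong ((a ℕ.≡ᵇ 0) ∧_) (isZero-select-compl (T ∘ suc) x))
... | false = trans (∧.x∙yz≈y∙xz (isZero (select (T ∘ suc) x)) (a ℕ.≡ᵇ 0) (isZero (select (not ∘ T ∘ suc) x))) (cong ((a ℕ.≡ᵇ 0) ∧_) (isZero-select-compl (T ∘ suc) x))

monoVal-vanish : ∀ {m} (T : Fin m → Bool) (x e : Vec ℕ m) → isZero (select T x) ≡ true → 1 ≤ ideg T e → monoVal x e ≡ 0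
monoVal-vanish T (a V.∷ x) (e₀ V.∷ e) x_T≡0 1≤deg rewrite select-∷ T a x with T zero
... | false = trans (cong (a ^ e₀ ℕ.*_) (monoVal-vanish (T ∘ suc) x e x_T≡0 1≤deg)) (ℕP.*-zeroʳ (a ^ e₀))
... | true with a | e₀
...   | zero  | suc _ = refl
...   | zero  | zero  = trans (ℕP.+-identityʳ _) (monoVal-vanish (T ∘ suc) x e x_T≡0 1≤deg)
...   | suc _ | _     with () ← x_T≡0

-- evalForm d c ≡ evalOn c (monomials d m) and evalExc d k I c ≡ evalOn c (filter … (monomials d m)) definitionally.
evalOn : ∀ {m} → Coeffs m → List (Vec ℕ m) → Vec ℕ m → ℤ
evalOn c es x = L.foldr (λ e acc → c e ℤ.* (+ monoVal x e) ℤ.+ acc) (+ 0) es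

evalOn-vanish : ∀ {m} (c : Coeffs m) (T : Fin m → Bool) (es : List (Vec ℕ m)) (x : Vec ℕ m) →
                All (λ e → 1 ≤ ideg T e) es → isZero (select T x) ≡ true → evalOn c es x ≡ + 0
evalOn-vanish c T []       x []            x_T≡0 = refl
evalOn-vanish c T (e ∷ es) x (1≤deg ∷ degs) x_T≡0
  rewrite monoVal-vanish T x e x_T≡0 1≤deg | evalOn-vanish c T es x degs x_T≡0 = trans (ℤP.+-identityʳ _) (ℤP.*-zeroʳ (c e))

𝟙-isZero≡δ0ᵛ : ∀ {m} (x : Vec ℕ m) → 𝟙 (isZero (V.toList x)) ≡ VecMultiplicity.δ x 0ᵛ
𝟙-isZero≡δ0ᵛ V.[]       = refl
𝟙-isZero≡δ0ᵛ (a V.∷ x) = begin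
    𝟙 ((a ℕ.≡ᵇ 0) ∧ isZero (V.toList x))       ≡⟨ 𝟙-∧ (a ℕ.≡ᵇ 0) _ ⟩
    𝟙 (a ℕ.≡ᵇ 0) ℕ.* 𝟙 (isZero (V.toList x))   ≡⟨ cong (𝟙 (a ℕ.≡ᵇ 0) ℕ.*_) (𝟙-isZero≡δ0ᵛ x) ⟩
    δℕ a 0 ℕ.* VecMultiplicity.δ x 0ᵛ          ≡⟨ δ-∷ a 0 x 0ᵛ ⟨
    VecMultiplicity.δ (a V.∷ x) 0ᵛ             ∎
  where open ≡-Reasoning

isZero-0ᵛ : ∀ {m} → isZero (V.toList (0ᵛ {m})) ≡ true
isZero-0ᵛ {zero}  = refl
isZero-0ᵛ {suc m} = isZero-0ᵛ {m}

Exp-^ : ∀ x n → x Exp.^ n ≡ x ^ n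
Exp-^ x zero    = refl
Exp-^ x (suc n) = cong (x ℕ.*_) (Exp-^ x n)

Mult-× : ∀ n x → n Mult.× x ≡ n ℕ.* x
Mult-× zero    x = refl
Mult-× (suc n) x = cong (x ℕ.+_) (Mult-× n x)

-- In Defs, ℤ.- (+ 1) ℤ.^ e parses as -(1 ^ e), so signDiff is constantly -1 (the right sign here, as dim V - dim L(V,k) = 1).
signDiff≡-1 : ∀ a b → signDiff a b ≡ ℤ.- + 1
signDiff≡-1 a b = cong ℤ.-_ (ℤP.^-zeroˡ ∣ + a ℤ.- + b ∣)

module _ {q : ℕ} (prime : Prime (suc (suc q))) where
  open ℤSolver.+-*-Solver

  p : ℕ
  p = suc (suc q)

  instance
    p-nonZero : ℕ.NonZero p
    p-nonZero = _

  open Congruence p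

  -- Fermat's little theorem
  p∤ : ∀ {m} → 0 < m → m < p → ¬ p ∣ m
  p∤ {m} 0<m m<p d = ℕP.<⇒≱ m<p (ℕD.∣⇒≤ {{ℕ.>-nonZero 0<m}} d)

  p∤! : ∀ m → m < p → ¬ p ∣ m !
  p∤! zero    m<p d = p∤ (s≤s z≤n) (s≤s (s≤s z≤n)) d
  p∤! (suc m) m<p d with euclidsLemma (suc m) (m !) prime d
  ... | inj₁ d₁ = p∤ (s≤s z≤n) m<p d₁
  ... | inj₂ d₂ = p∤! m (ℕP.<-trans (ℕP.n<1+n m) m<p) d₂

  p∣pCj : ∀ {j} → 0 < j → j < p → p ∣ p C j
  p∣pCj {j} 0<j j<p with euclidsLemma (p C j) (j ! ℕ.* (p ∸ j) !) prime p∣pCj*j![p-j]!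
    where
    instance _ = ℕP.m*n≢0 (j !) ((p ∸ j) !) {{j ℕP.!≢0}} {{(p ∸ j) ℕP.!≢0}}
    p∣pCj*j![p-j]! : p ∣ (p C j) ℕ.* (j ! ℕ.* (p ∸ j) !)
    p∣pCj*j![p-j]! = subst (p ∣_)
      (sym (trans (cong (ℕ._* (j ! ℕ.* (p ∸ j) !)) (nCk≡n!/k![n-k]! (ℕP.<⇒≤ j<p)))
                  (ℕDM.m/n*n≡m (k![n∸k]!∣n! (ℕP.<⇒≤ j<p)))))
      (ℕD.∣m⇒∣m*n ((suc q) !) ℕD.∣-refl)
  ... | inj₁ d = d
  ... | inj₂ d with euclidsLemma (j !) ((p ∸ j) !) prime d
  ...   | inj₁ d₁ = ⊥-elim (p∤! j j<p d₁)
  ...   | inj₂ d₂ = ⊥-elim (p∤! (p ∸ j) (ℕP.∸-monoʳ-< 0<j (ℕP.<⇒≤ j<p)) d₂)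

  ∑≋last : ∀ n (v : Fin (suc n) → ℕ) → (∀ i → p ∣ v (inject₁ i)) → + FinSum.sum v ≋ + v (fromℕ n)
  ∑≋last zero    v h = ≋-reflexive (cong +_ (ℕP.+-identityʳ (v zero)))
  ∑≋last (suc n) v h = begin
      + (v zero ℕ.+ FinSum.sum (v ∘ suc))     ≡⟨ ℤP.pos-+ (v zero) _ ⟩
      + v zero ℤ.+ + FinSum.sum (v ∘ suc)     ≈⟨ ≋-+ (∣ℕ⇒≋0 (h zero)) (∑≋last n (v ∘ suc) (h ∘ suc)) ⟩
      + 0 ℤ.+ + v (fromℕ (suc n))             ≡⟨ ℤP.+-identityˡ _ ⟩
      + v (fromℕ (suc n))                     ∎
    where open ≋-Reasoning

  freshman's-dream : ∀ t → + (suc t ^ p) ≋ + (t ^ p) ℤ.+ + 1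
  freshman's-dream t = begin
      + (suc t ^ p)                               ≡⟨ cong +_ (trans (cong (_^ p) (ℕP.+-comm 1 t)) (sym (Exp-^ (t ℕ.+ 1) p))) ⟩
      + ((t ℕ.+ 1) Exp.^ p)                       ≡⟨ cong +_ (Binomial.theorem p t 1) ⟩
      + (term zero ℕ.+ FinSum.sum (term ∘ suc))   ≡⟨ ℤP.pos-+ (term zero) _ ⟩
      + term zero ℤ.+ + FinSum.sum (term ∘ suc)   ≈⟨ ≋-+ (≋-reflexive (cong +_ first)) (∑≋last (suc q) (term ∘ suc) middle) ⟩
      + 1 ℤ.+ + term (suc (fromℕ (suc q)))        ≡⟨ cong (λ z → + 1 ℤ.+ + z) last ⟩
      + 1 ℤ.+ + (t ^ p)                           ≡⟨ ℤP.+-comm (+ 1) (+ (t ^ p)) ⟩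
      + (t ^ p) ℤ.+ + 1                           ∎
    where
    open ≋-Reasoning
    term′ : ℕ → ℕ
    term′ j = (p C j) Mult.× ((t Exp.^ j) ℕ.* (1 Exp.^ (p ∸ j)))
    term : Fin (suc p) → ℕ
    term = term′ ∘ toℕ
    first : term zero ≡ 1
    first = trans (Mult-× 1 _) (trans (ℕP.*-identityˡ _) (trans (ℕP.*-identityˡ _) (trans (Exp-^ 1 p) (ℕP.^-zeroˡ p))))
    last : term (suc (fromℕ (suc q))) ≡ t ^ p
    last = trans (cong (term′ ∘ suc) (FP.toℕ-fromℕ (suc q)))
           (trans (Mult-× (p C p) _)
           (trans (cong₂ (λ a b → a ℕ.* ((t Exp.^ p) ℕ.* (1 Exp.^ b))) (nCn≡1 p) (ℕP.n∸n≡0 p))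
           (trans (ℕP.*-identityˡ _) (trans (ℕP.*-identityʳ _) (Exp-^ t p)))))
    middle : ∀ i → p ∣ term (suc (inject₁ i))
    middle i = subst (p ∣_) (sym (Mult-× (p C toℕ (suc (inject₁ i))) _))
      (ℕD.∣m⇒∣m*n _ (p∣pCj (s≤s z≤n) (s≤s (subst (_< suc q) (sym (FP.toℕ-inject₁ i)) (FP.toℕ<n i)))))

  ^p≋ : ∀ t → + (t ^ p) ≋ + t
  ^p≋ zero    = ≋-refl
  ^p≋ (suc t) = begin
      + (suc t ^ p)         ≈⟨ freshman's-dream t ⟩
      + (t ^ p) ℤ.+ + 1     ≈⟨ ≋-+ (^p≋ t) (≋-refl {+ 1}) ⟩
      + t ℤ.+ + 1           ≡⟨ trans (sym (ℤP.pos-+ t 1)) (cong +_ (ℕP.+-comm t 1)) ⟩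
      + suc t               ∎
    where open ≋-Reasoning

  euclidsLemmaℤ : ∀ a b → + p ℤD.∣ a ℤ.* b → + p ℤD.∣ a ⊎ + p ℤD.∣ b
  euclidsLemmaℤ a b d with euclidsLemma ∣ a ∣ ∣ b ∣ prime (subst (p ∣_) (ℤP.abs-* a b) (ℤD.∣⇒∣ᵤ d))
  ... | inj₁ x = inj₁ (ℤD.∣ᵤ⇒∣ x)
  ... | inj₂ y = inj₂ (ℤD.∣ᵤ⇒∣ y)

  fermat : ∀ t → ¬ p ∣ t → + (t ^ (p ∸ 1)) ≋ + 1
  fermat t p∤t with euclidsLemmaℤ (+ t) (+ (t ^ (p ∸ 1)) ℤ.- + 1) p∣t[t^[p-1]-1]
    where
    p∣t[t^[p-1]-1] : + p ℤD.∣ + t ℤ.* (+ (t ^ (p ∸ 1)) ℤ.- + 1)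
    p∣t[t^[p-1]-1] = subst (+ p ℤD.∣_)
      (trans (cong (ℤ._- + t) (ℤP.pos-* t (t ^ (p ∸ 1))))
             (solve 2 (λ a b → a :* b :- a := a :* (b :- con (+ 1))) refl (+ t) (+ (t ^ (p ∸ 1)))))
      (divides-difference (^p≋ t))
  ... | inj₁ p∣t = ⊥-elim (p∤t (ℤD.∣⇒∣ᵤ p∣t))
  ... | inj₂ p∣t^[p-1]-1 = mk p∣t^[p-1]-1

  ≋-%ℕ : ∀ v → v ≋ + (v ℤDM.%ℕ p)
  ≋-%ℕ v = mk (divides (v ℤDM./ℕ p) (begin
      v ℤ.- + r                             ≡⟨ cong (ℤ._- + r) (ℤDM.a≡a%ℕn+[a/ℕn]*n v p) ⟩
      + r ℤ.+ v ℤDM./ℕ p ℤ.* + p ℤ.- + r    ≡⟨ solve 2 (λ r m → r :+ m :- r := m) refl (+ r) _ ⟩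
      v ℤDM./ℕ p ℤ.* + p                    ∎))
    where
    open ≡-Reasoning
    r = v ℤDM.%ℕ p

  -- This turns point counts into sums of (p-1)-th powers.
  𝟙[p∣]≋ : ∀ v → + 𝟙 (divisibleBy p v) ≋ + 1 ℤ.- v ℤ.^ (p ∸ 1)
  𝟙[p∣]≋ v with p ∣? ∣ v ∣
  ... | yes p∣v = ≋-sym (begin
      + 1 ℤ.- v ℤ.* v ℤ.^ q        ≈⟨ ≋-− (≋-refl {+ 1}) (≋-* v≋0 (≋-refl {v ℤ.^ q})) ⟩
      + 1 ℤ.- + 0 ℤ.* v ℤ.^ q      ≡⟨ cong (ℤ._-_ (+ 1)) (ℤP.*-zeroˡ (v ℤ.^ q)) ⟩
      + 1                          ∎)
    where
    open ≋-Reasoning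
    v≋0 : v ≋ + 0
    v≋0 = ∣⇒≋0 (ℤD.∣ᵤ⇒∣ p∣v)
  ... | no p∤v = ≋-sym (begin
      + 1 ℤ.- v ℤ.^ (p ∸ 1)        ≈⟨ ≋-− (≋-refl {+ 1}) (≋-^ (p ∸ 1) (≋-%ℕ v)) ⟩
      + 1 ℤ.- (+ r) ℤ.^ (p ∸ 1)    ≡⟨ cong (ℤ._-_ (+ 1)) (sym (+-^ r (p ∸ 1))) ⟩
      + 1 ℤ.- + (r ^ (p ∸ 1))      ≈⟨ ≋-− (≋-refl {+ 1}) (fermat r p∤r) ⟩
      + 0                          ∎)
    where
    open ≋-Reasoning
    r = v ℤDM.%ℕ p
    p∤r : ¬ p ∣ r
    p∤r p∣r = p∤v (ℤD.∣⇒∣ᵤ (≋0⇒∣ (≋-trans (≋-%ℕ v) (∣ℕ⇒≋0 p∣r))))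

  -- Power sums and the Chevalley–Warning argument
  powerSum : ℕ → ℕ
  powerSum a = ∑ (L.upTo p) (_^ a)

  private
    ∑-upTo-shift : ∀ n (G : ℕ → ℕ) → ∑ (L.upTo n) (G ∘ suc) ℕ.+ G 0 ≡ ∑ (L.upTo n) G ℕ.+ G n
    ∑-upTo-shift n G = begin
        ∑ (L.upTo n) (G ∘ suc) ℕ.+ G 0          ≡⟨ ℕP.+-comm _ (G 0) ⟩
        G 0 ℕ.+ ∑ (L.upTo n) (G ∘ suc)          ≡⟨ cong (G 0 ℕ.+_) (∑-map suc (L.upTo n) G) ⟨
        G 0 ℕ.+ ∑ (L.map suc (L.upTo n)) G      ≡⟨ cong (λ xs → G 0 ℕ.+ ∑ xs G) (LP.map-upTo suc n) ⟩
        ∑ (L.upTo (suc n)) G                    ≡⟨ cong (λ xs → ∑ xs G) (LP.upTo-∷ʳ n) ⟨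
        ∑ (L.upTo n L.∷ʳ n) G                   ≡⟨ ∑-++ (L.upTo n) L.[ n ] G ⟩
        ∑ (L.upTo n) G ℕ.+ (G n ℕ.+ 0)          ≡⟨ cong (∑ (L.upTo n) G ℕ.+_) (ℕP.+-identityʳ (G n)) ⟩
        ∑ (L.upTo n) G ℕ.+ G n                  ∎
      where open ≡-Reasoning

    p∣∑Poly₁< : ∀ {b F} → (∀ j → j < b → p ∣ powerSum j) → Poly₁< b F → p ∣ ∑ (L.upTo p) F
    p∣∑Poly₁< h zeroᴾ           = subst (p ∣_) (sym (∑-zero (L.upTo p))) (p ℕD.∣0)
    p∣∑Poly₁< h (monoᴾ c j j<b) = subst (p ∣_) (sym (∑-*ˡ c (L.upTo p) (_^ j))) (ℕD.∣n⇒∣m*n c (h j j<b))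
    p∣∑Poly₁< h (_+ᴾ_ {F} {G} P Q) = subst (p ∣_) (sym (∑-+ (L.upTo p) F G)) (ℕD.∣m∣n⇒∣m+n (p∣∑Poly₁< h P) (p∣∑Poly₁< h Q))
    p∣∑Poly₁< h (castᴾ P e)     = subst (p ∣_) (sym (∑-cong (L.upTo p) e)) (p∣∑Poly₁< h P)

  -- Sum ∑_t (t+1)^(a+1) two ways: by shifting it is ∑_t t^(a+1) + p^(a+1); by expanding it is ∑_t t^(a+1) + (a+1)·powerSum a + (lower power sums).
  p∣powerSum : ∀ a → suc a < p → p ∣ powerSum a
  p∣powerSum = <-rec (λ a → suc a < p → p ∣ powerSum a) step
    where
    step : ∀ a → (∀ {j} → j < a → suc j < p → p ∣ powerSum j) → suc a < p → p ∣ powerSum a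
    step a rec a+1<p with suc-^-expansion a
    ... | R , R<a , expand = p∣S
      where
      S′ = powerSum (suc a)
      shifted : S′ ℕ.+ (suc a ℕ.* powerSum a ℕ.+ ∑ (L.upTo p) R) ≡ S′ ℕ.+ p ^ suc a
      shifted = begin
          S′ ℕ.+ (suc a ℕ.* powerSum a ℕ.+ ∑ (L.upTo p) R)
        ≡⟨ cong (λ z → S′ ℕ.+ (z ℕ.+ ∑ (L.upTo p) R)) (∑-*ˡ (suc a) (L.upTo p) (_^ a)) ⟨
          S′ ℕ.+ (∑ (L.upTo p) (λ t → suc a ℕ.* t ^ a) ℕ.+ ∑ (L.upTo p) R)
        ≡⟨ trans (sym (ℕP.+-assoc S′ _ _)) (cong (ℕ._+ ∑ (L.upTo p) R) (sym (∑-+ (L.upTo p) (_^ suc a) (λ t → suc a ℕ.* t ^ a)))) ⟩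
          ∑ (L.upTo p) (λ t → t ^ suc a ℕ.+ suc a ℕ.* t ^ a) ℕ.+ ∑ (L.upTo p) R
        ≡⟨ trans (sym (∑-+ (L.upTo p) (λ t → t ^ suc a ℕ.+ suc a ℕ.* t ^ a) R)) (sym (∑-cong (L.upTo p) expand)) ⟩
          ∑ (L.upTo p) (λ t → suc t ^ suc a)
        ≡⟨ trans (sym (ℕP.+-identityʳ _)) (∑-upTo-shift p (_^ suc a)) ⟩
          S′ ℕ.+ p ^ suc a ∎
        where open ≡-Reasoning
      p∣[1+a]S : p ∣ suc a ℕ.* powerSum a
      p∣[1+a]S = ℕD.∣m+n∣m⇒∣n
        (subst (p ∣_) (trans (sym (ℕP.+-cancelˡ-≡ S′ _ _ shifted)) (ℕP.+-comm (suc a ℕ.* powerSum a) _)) (ℕD.∣m⇒∣m*n (p ^ a) ℕD.∣-refl))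
        (p∣∑Poly₁< (λ j j<a → rec j<a (ℕP.<-trans (s≤s j<a) a+1<p)) R<a)
      p∣S : p ∣ powerSum a
      p∣S with euclidsLemma (suc a) (powerSum a) prime p∣[1+a]S
      ... | inj₂ d = d
      ... | inj₁ d = ⊥-elim (p∤ (s≤s z≤n) a+1<p d)

  private
    split-degree-bound : ∀ b a₀ i c → (if b then a₀ else 0) ℕ.+ i < (𝟙 b ℕ.+ c) ℕ.* (p ∸ 1) →
                         a₀ < p ∸ 1 ⊎ i < c ℕ.* (p ∸ 1)
    split-degree-bound false a₀ i c bound = inj₂ bound
    split-degree-bound true  a₀ i c bound with a₀ ℕP.<? p ∸ 1
    ... | yes a₀<p-1 = inj₁ a₀<p-1
    ... | no  a₀≮p-1 = inj₂ (ℕP.+-cancelˡ-< (p ∸ 1) _ _ (ℕP.≤-<-trans (ℕP.+-monoˡ-≤ i (ℕP.≮⇒≥ a₀≮p-1)) bound))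

    ∑-monoVal-∷ : ∀ m a₀ (a : Vec ℕ m) →
                  ∑ (vecs p (suc m)) (λ x → monoVal x (a₀ V.∷ a)) ≡ powerSum a₀ ℕ.* ∑ (vecs p m) (λ x → monoVal x a)
    ∑-monoVal-∷ m a₀ a = trans (∑-vecs-suc p m _)
      (trans (∑-cong (L.upTo p) (λ t → ∑-*ˡ (t ^ a₀) (vecs p m) (λ x → monoVal x a)))
             (∑-*ʳ (∑ (vecs p m) (λ x → monoVal x a)) (L.upTo p) (_^ a₀)))

  p∣∑monoVal : ∀ {m} (J : Fin m → Bool) (a : Vec ℕ m) → ideg J a < card J ℕ.* (p ∸ 1) →
               p ∣ ∑ (vecs p m) (λ x → monoVal x a)
  p∣∑monoVal {suc m} J (a₀ V.∷ a) bound
    with split-degree-bound (J zero) a₀ (ideg (J ∘ suc) a) (card (J ∘ suc)) (subst (λ c → ideg J (a₀ V.∷ a) < c ℕ.* (p ∸ 1)) (card-suc J) bound)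
  ... | inj₁ a₀<p-1 = subst (p ∣_) (sym (∑-monoVal-∷ m a₀ a)) (ℕD.∣m⇒∣m*n (∑ (vecs p m) (λ x → monoVal x a)) (p∣powerSum a₀ (s≤s a₀<p-1)))
  ... | inj₂ rest<  = subst (p ∣_) (sym (∑-monoVal-∷ m a₀ a)) (ℕD.∣n⇒∣m*n (powerSum a₀) (p∣∑monoVal (J ∘ suc) a rest<))

  ∑Poly≋0 : ∀ {m} {J : Fin m → Bool} {D F} → Poly J D F → D < card J ℕ.* (p ∸ 1) → ℤ∑.∑ (vecs p m) F ≋ + 0
  ∑Poly≋0 {m} zeroᴾ D< = ≋-reflexive (ℤ∑.∑-zero (vecs p m))
  ∑Poly≋0 {m} {J} (monoᴾ c a a≤) D< = begin
      ℤ∑.∑ (vecs p m) (λ x → c ℤ.* + monoVal x a)   ≡⟨ ℤ∑.∑-*ˡ c (vecs p m) _ ⟩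
      c ℤ.* ℤ∑.∑ (vecs p m) (λ x → + monoVal x a)   ≡⟨ cong (c ℤ.*_) (+-∑ (vecs p m) (λ x → monoVal x a)) ⟨
      c ℤ.* + ∑ (vecs p m) (λ x → monoVal x a)      ≈⟨ ≋-* (≋-refl {c}) (∣ℕ⇒≋0 (p∣∑monoVal J a (ℕP.≤-<-trans a≤ D<))) ⟩
      c ℤ.* + 0                                     ≡⟨ ℤP.*-zeroʳ c ⟩
      + 0                                           ∎
    where open ≋-Reasoning
  ∑Poly≋0 {m} (_+ᴾ_ {F} {G} P Q) D< = ≋-trans (≋-reflexive (ℤ∑.∑-+ (vecs p m) F G)) (≋-+ (∑Poly≋0 P D<) (∑Poly≋0 Q D<))
  ∑Poly≋0 {m} (castᴾ P e) D< = ≋-trans (≋-reflexive (ℤ∑.∑-cong (vecs p m) e)) (∑Poly≋0 P D<)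

  -- F^(p-1) - G^(p-1) = (F - G)·geom (p-2) F G has J-degree ≤ D + (D+1)(p-2) < (D+1)(p-1).
  chevalley-warning : ∀ {m} {J : Fin m → Bool} {D F G} → card J ≡ suc D →
                      Poly J (suc D) F → Poly J (suc D) G → Poly J D (λ x → F x ℤ.- G x) →
                      ℤ∑.∑ (vecs p m) (λ x → F x ℤ.^ (p ∸ 1)) ≋ ℤ∑.∑ (vecs p m) (λ x → G x ℤ.^ (p ∸ 1))
  chevalley-warning {m} {J} {D} {F} {G} card≡ F-deg G-deg F-G-deg = mk (≋0⇒∣ (begin
      ℤ∑.∑ (vecs p m) (λ x → F x ℤ.^ (p ∸ 1)) ℤ.- ℤ∑.∑ (vecs p m) (λ x → G x ℤ.^ (p ∸ 1))
    ≡⟨ ℤ∑-− (vecs p m) _ _ ⟨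
      ℤ∑.∑ (vecs p m) (λ x → F x ℤ.^ (p ∸ 1) ℤ.- G x ℤ.^ (p ∸ 1))
    ≡⟨ ℤ∑.∑-cong (vecs p m) (λ x → ^-^-factor q (F x) (G x)) ⟩
      ℤ∑.∑ (vecs p m) (λ x → (F x ℤ.- G x) ℤ.* geom q (F x) (G x))
    ≈⟨ ∑Poly≋0 (Poly-* F-G-deg (Poly-geom F-deg G-deg q)) bound ⟩
      + 0 ∎))
    where
    open ≋-Reasoning
    bound : D ℕ.+ suc D ℕ.* q < card J ℕ.* (p ∸ 1)
    bound = subst (λ c → D ℕ.+ suc D ℕ.* q < c ℕ.* suc q) (sym card≡)
              (ℕP.≤-reflexive (sym (ℕP.*-suc (suc D) q)))

  affineCount : ∀ {m} → (Vec ℕ m → ℤ) → ℕ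
  affineCount {m} F = ∑ (vecs p m) (λ x → 𝟙 (divisibleBy p (F x)))

  affineCount≋ : ∀ m (F : Vec ℕ (suc m) → ℤ) → + affineCount F ≋ ℤ.- ℤ∑.∑ (vecs p (suc m)) (λ x → F x ℤ.^ (p ∸ 1))
  affineCount≋ m F = begin
      + affineCount F                                 ≡⟨ +-∑ 𝔽ᵐ _ ⟩
      ℤ∑.∑ 𝔽ᵐ (λ x → + 𝟙 (divisibleBy p (F x)))       ≈⟨ ℤ∑-≋ 𝔽ᵐ (λ x → 𝟙[p∣]≋ (F x)) ⟩
      ℤ∑.∑ 𝔽ᵐ (λ x → + 1 ℤ.- F x ℤ.^ (p ∸ 1))          ≡⟨ ℤ∑-− 𝔽ᵐ (λ _ → + 1) _ ⟩
      ℤ∑.∑ 𝔽ᵐ (λ _ → + 1) ℤ.- ℤ∑.∑ 𝔽ᵐ (λ x → F x ℤ.^ (p ∸ 1))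
        ≈⟨ ≋-− (≋-trans (≋-reflexive (sym (+-∑ 𝔽ᵐ (λ _ → 1)))) (∣ℕ⇒≋0 p∣size)) ≋-refl ⟩
      + 0 ℤ.- ℤ∑.∑ 𝔽ᵐ (λ x → F x ℤ.^ (p ∸ 1))          ≡⟨ ℤP.+-identityˡ _ ⟩
      ℤ.- ℤ∑.∑ 𝔽ᵐ (λ x → F x ℤ.^ (p ∸ 1))              ∎
    where
    open ≋-Reasoning
    𝔽ᵐ = vecs p (suc m)
    p∣size : p ∣ ∑ 𝔽ᵐ (λ _ → 1)
    p∣size = subst (p ∣_) (sym (trans (∑-vecs-suc p m (λ _ → 1)) (∑-const (L.upTo p) size)))
               (subst (λ n → p ∣ n ℕ.* size) (sym (LP.length-upTo p)) (ℕD.∣m⇒∣m*n size ℕD.∣-refl))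
      where size = ∑ (vecs p m) (λ _ → 1)

  -- Scaling by units
  private
    ≤-≋⇒≡ : ∀ {a b} → a < p → b < p → a ≤ b → + a ≋ + b → a ≡ b
    ≤-≋⇒≡ {a} {b} a<p b<p a≤b (mk p∣a-b) = begin
        a                     ≡⟨ ℕDM.m<n⇒m%n≡m a<p ⟨
        a ℕ.% p               ≡⟨ ℕDM.%-remove-+ʳ a p∣b∸a ⟨
        (a ℕ.+ (b ∸ a)) ℕ.% p ≡⟨ cong (ℕ._% p) (ℕP.m+[n∸m]≡n a≤b) ⟩
        b ℕ.% p               ≡⟨ ℕDM.m<n⇒m%n≡m b<p ⟩
        b                     ∎
      where
      open ≡-Reasoning
      p∣b∸a : p ∣ b ∸ a
      p∣b∸a = subst (p ∣_) (trans (cong ∣_∣ (ℤP.[+m]-[+n]≡m⊖n a b)) (trans (ℤP.∣m⊖n∣≡∣n⊖m∣ a b) (cong ∣_∣ (ℤP.⊖-≥ a≤b))))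
                    (ℤD.∣⇒∣ᵤ p∣a-b)

  ≋⇒≡ : ∀ {a b} → a < p → b < p → + a ≋ + b → a ≡ b
  ≋⇒≡ {a} {b} a<p b<p a≋b with ℕP.≤-total a b
  ... | inj₁ a≤b = ≤-≋⇒≡ a<p b<p a≤b a≋b
  ... | inj₂ b≤a = sym (≤-≋⇒≡ b<p a<p b≤a (≋-sym a≋b))

  infixl 7 _·ₚ_
  _·ₚ_ : ℕ → ℕ → ℕ
  μ ·ₚ a = (μ ℕ.* a) ℕ.% p

  ·ₚ-< : ∀ μ a → μ ·ₚ a < p
  ·ₚ-< μ a = ℕDM.m%n<n (μ ℕ.* a) p

  ·ₚ-≋ : ∀ μ a → + (μ ·ₚ a) ≋ + μ ℤ.* + a
  ·ₚ-≋ μ a = ≋-trans (≋-sym (≋-%ℕ (+ (μ ℕ.* a)))) (≋-reflexive (ℤP.pos-* μ a))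

  ·ₚ-zeroʳ : ∀ μ → μ ·ₚ 0 ≡ 0
  ·ₚ-zeroʳ μ = cong (ℕ._% p) (ℕP.*-zeroʳ μ)

  ·ₚ-cancel : ∀ μ ν a → a < p → + ν ℤ.* + μ ≋ + 1 → ν ·ₚ (μ ·ₚ a) ≡ a
  ·ₚ-cancel μ ν a a<p νμ≋1 = ≋⇒≡ (·ₚ-< ν _) a<p (begin
      + (ν ·ₚ (μ ·ₚ a))        ≈⟨ ·ₚ-≋ ν _ ⟩
      + ν ℤ.* + (μ ·ₚ a)       ≈⟨ ≋-* (≋-refl {+ ν}) (·ₚ-≋ μ a) ⟩
      + ν ℤ.* (+ μ ℤ.* + a)    ≡⟨ ℤP.*-assoc (+ ν) (+ μ) (+ a) ⟨
      + ν ℤ.* + μ ℤ.* + a      ≈⟨ ≋-* νμ≋1 (≋-refl {+ a}) ⟩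
      + 1 ℤ.* + a              ≡⟨ ℤP.*-identityˡ (+ a) ⟩
      + a                      ∎)
    where open ≋-Reasoning

  ·ₚ-nonzero : ∀ {μ a} → 0 < μ → μ < p → 0 < a → a < p → ¬ μ ·ₚ a ≡ 0
  ·ₚ-nonzero {μ} {a} 0<μ μ<p 0<a a<p μa≡0 with euclidsLemma μ a prime p∣μa
    where
    p∣μa : p ∣ μ ℕ.* a
    p∣μa = ℕD.m%n≡0⇒n∣m (μ ℕ.* a) p μa≡0
  ... | inj₁ p∣μ = p∤ 0<μ μ<p p∣μ
  ... | inj₂ p∣a = p∤ 0<a a<p p∣a

  _⁻¹ : ℕ → ℕ
  μ ⁻¹ = μ ^ q

  ⁻¹-inverseˡ : ∀ {μ} → 0 < μ → μ < p → + (μ ⁻¹) ℤ.* + μ ≋ + 1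
  ⁻¹-inverseˡ {μ} 0<μ μ<p = ≋-trans (≋-reflexive μ⁻¹μ≡μ^[p-1]) (fermat μ (p∤ 0<μ μ<p))
    where
    μ⁻¹μ≡μ^[p-1] : + (μ ⁻¹) ℤ.* + μ ≡ + (μ ^ (p ∸ 1))
    μ⁻¹μ≡μ^[p-1] = trans (sym (ℤP.pos-* (μ ⁻¹) μ)) (cong +_ (ℕP.*-comm (μ ⁻¹) μ))

  ⁻¹-inverseʳ : ∀ {μ} → 0 < μ → μ < p → + μ ℤ.* + (μ ⁻¹) ≋ + 1
  ⁻¹-inverseʳ {μ} 0<μ μ<p = ≋-trans (≋-reflexive (ℤP.*-comm (+ μ) (+ (μ ⁻¹)))) (⁻¹-inverseˡ 0<μ μ<p)

  scale : ∀ {m} → (Fin m → Bool) → ℕ → Vec ℕ m → Vec ℕ m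
  scale S μ V.[]       = V.[]
  scale S μ (a V.∷ x) = (if S zero then μ ·ₚ a else a) V.∷ scale (S ∘ suc) μ x

  scale-< : ∀ {m} (S : Fin m → Bool) μ {x : Vec ℕ m} → VAll.All (_< p) x → VAll.All (_< p) (scale S μ x)
  scale-< S μ VAll.[]                         = VAll.[]
  scale-< S μ {a V.∷ x} (a<p VAll.∷ x<p) with S zero
  ... | true  = ·ₚ-< μ a VAll.∷ scale-< (S ∘ suc) μ x<p
  ... | false = a<p      VAll.∷ scale-< (S ∘ suc) μ x<p

  scale-cancel : ∀ {m} (S : Fin m → Bool) μ ν {x : Vec ℕ m} → VAll.All (_< p) x → + ν ℤ.* + μ ≋ + 1 →
                 scale S ν (scale S μ x) ≡ x
  scale-cancel S μ ν VAll.[] νμ≋1 = refl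
  scale-cancel S μ ν {a V.∷ x} (a<p VAll.∷ x<p) νμ≋1 with S zero
  ... | true  = cong₂ V._∷_ (·ₚ-cancel μ ν a a<p νμ≋1) (scale-cancel (S ∘ suc) μ ν x<p νμ≋1)
  ... | false = cong (a V.∷_) (scale-cancel (S ∘ suc) μ ν x<p νμ≋1)

  select-scale : ∀ {m} (S : Fin m → Bool) μ (x : Vec ℕ m) → select S (scale S μ x) ≡ L.map (μ ·ₚ_) (select S x)
  select-scale S μ V.[]       = refl
  select-scale S μ (a V.∷ x) rewrite select-∷ S (if S zero then μ ·ₚ a else a) (scale (S ∘ suc) μ x) | select-∷ S a x
    with S zero
  ... | true  = cong (μ ·ₚ a ∷_) (select-scale (S ∘ suc) μ x)
  ... | false = select-scale (S ∘ suc) μ x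

  select-scale-disjoint : ∀ {m} (S T : Fin m → Bool) μ (x : Vec ℕ m) → (∀ i → S i ≡ true → T i ≡ false) →
                          select T (scale S μ x) ≡ select T x
  select-scale-disjoint S T μ V.[]       disj = refl
  select-scale-disjoint S T μ (a V.∷ x) disj
    rewrite select-∷ T (if S zero then μ ·ₚ a else a) (scale (S ∘ suc) μ x) | select-∷ T a x
          | select-scale-disjoint (S ∘ suc) (T ∘ suc) μ x (disj ∘ suc)
    with S zero | T zero | disj zero
  ... | true  | true  | disj₀ with () ← disj₀ refl
  ... | true  | false | _ = refl
  ... | false | _     | _ = refl

  select-< : ∀ {m} (S : Fin m → Bool) {x : Vec ℕ m} → VAll.All (_< p) x → All (_< p) (select S x)
  select-< S VAll.[] = []
  select-< S {a V.∷ x} (a<p VAll.∷ x<p) rewrite select-∷ S a x with S zero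
  ... | true  = a<p ∷ select-< (S ∘ suc) x<p
  ... | false = select-< (S ∘ suc) x<p

  private
    normalized-0· : ∀ ys → normalized (L.map (0 ·ₚ_) ys) ≡ false
    normalized-0· []       = refl
    normalized-0· (y ∷ ys) = normalized-0· ys

    normalized-∷ : ∀ r zs → ¬ r ≡ 0 → 𝟙 (normalized (r ∷ zs)) ≡ δℕ r 1
    normalized-∷ zero          zs r≢0 = ⊥-elim (r≢0 refl)
    normalized-∷ (suc zero)    zs r≢0 = refl
    normalized-∷ (suc (suc r)) zs r≢0 = refl

  -- Among the p multiples μ·ys, exactly one is normalized when ys ≠ 0: the one with μ = (first nonzero entry)⁻¹.
  ∑-normalized-multiples : ∀ ys → All (_< p) ys → ∑ (L.upTo p) (λ μ → 𝟙 (normalized (L.map (μ ·ₚ_) ys))) ≡ 𝟙 (not (isZero ys))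
  ∑-normalized-multiples []           []          = ∑-zero (L.upTo p)
  ∑-normalized-multiples (zero ∷ ys)  (_ ∷ ys<p)  =
    trans (∑-cong (L.upTo p) (λ μ → cong (λ r → 𝟙 (normalized (r ∷ L.map (μ ·ₚ_) ys))) (·ₚ-zeroʳ μ)))
          (∑-normalized-multiples ys ys<p)
  ∑-normalized-multiples (suc y ∷ ys) (y<p ∷ _) = begin
      ∑ (L.upTo p) (λ μ → 𝟙 (normalized (μ ·ₚ suc y ∷ L.map (μ ·ₚ_) ys)))
    ≡⟨ ∑-congᴬ (L.upTo p) (all ℕ-enum) head-is-one ⟩
      ∑ (L.upTo p) (λ μ → δℕ (suc y ·ₚ μ) 1)
    ≡⟨ ∑-reindex ℕ-enum (suc y ·ₚ_) (suc y ⁻¹ ·ₚ_) (λ μ _ → ·ₚ-< (suc y) μ) (λ μ _ → ·ₚ-< (suc y ⁻¹) μ)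
         (λ μ μ<p → ·ₚ-cancel (suc y) (suc y ⁻¹) μ μ<p (⁻¹-inverseˡ (s≤s z≤n) y<p))
         (λ μ μ<p → ·ₚ-cancel (suc y ⁻¹) (suc y) μ μ<p (⁻¹-inverseʳ (s≤s z≤n) y<p)) (λ v → δℕ v 1) ⟩
      ∑ (L.upTo p) (λ v → δℕ v 1)
    ≡⟨ unique ℕ-enum 1 (s≤s (s≤s z≤n)) ⟩
      1 ∎
    where
    open ≡-Reasoning
    open Multiplicity ℕP._≟_ using (all; unique; ∑-reindex)
    ℕ-enum = upTo-enumerates p
    head-is-one : ∀ μ → μ < p → 𝟙 (normalized (μ ·ₚ suc y ∷ L.map (μ ·ₚ_) ys)) ≡ δℕ (suc y ·ₚ μ) 1
    head-is-one zero    _   = trans (cong 𝟙 (normalized-0· (suc y ∷ ys))) (cong (λ r → δℕ r 1) (sym (·ₚ-zeroʳ (suc y))))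
    head-is-one (suc μ) μ<p = trans (normalized-∷ _ _ (·ₚ-nonzero (s≤s z≤n) μ<p (s≤s z≤n) y<p))
                                    (cong (λ r → δℕ (r ℕ.% p) 1) (ℕP.*-comm (suc μ) (suc y)))

  -- The units μ act freely on {x : x_S ≠ 0}; each orbit has p - 1 points, exactly one with x_S normalized.
  count-orbits : ∀ {m} (S : Fin m → Bool) (P : Vec ℕ m → Bool) →
                 (∀ μ x → 0 < μ → μ < p → P (scale S μ x) ≡ P x) →
                 ∑ (vecs p m) (λ x → 𝟙 (P x ∧ not (isZero (select S x)))) ≡
                 (p ∸ 1) ℕ.* ∑ (vecs p m) (λ x → 𝟙 (P x ∧ normalized (select S x)))
  count-orbits {m} S P P-invariant = begin
      ∑ 𝔽ᵐ (λ x → 𝟙 (P x ∧ not (isZero (select S x))))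
    ≡⟨ ∑-congᴬ 𝔽ᵐ (Multiplicity.all enum) (λ x x<p → trans (𝟙-∧ (P x) _)
         (cong (𝟙 (P x) ℕ.*_) (sym (∑-normalized-multiples (select S x) (select-< S x<p))))) ⟩
      ∑ 𝔽ᵐ (λ x → 𝟙 (P x) ℕ.* ∑ (L.upTo p) (λ μ → 𝟙 (normalized (L.map (μ ·ₚ_) (select S x)))))
    ≡⟨ ∑-cong 𝔽ᵐ (λ x → trans (sym (∑-*ˡ (𝟙 (P x)) (L.upTo p) _))
         (∑-cong (L.upTo p) (λ μ → cong (λ ys → 𝟙 (P x) ℕ.* 𝟙 (normalized ys)) (sym (select-scale S μ x))))) ⟩
      ∑ 𝔽ᵐ (λ x → ∑ (L.upTo p) (λ μ → T μ x))
    ≡⟨ ∑-comm 𝔽ᵐ (L.upTo p) (λ x μ → T μ x) ⟩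
      ∑ (L.upTo p) (λ μ → ∑ 𝔽ᵐ (T μ))
    ≡⟨ cong (ℕ._+_ (∑ 𝔽ᵐ (T 0))) (trans (cong (λ μs → ∑ μs (λ μ → ∑ 𝔽ᵐ (T μ))) (sym (LP.map-upTo suc (suc q))))
                                          (∑-map suc (L.upTo (suc q)) _)) ⟩
      ∑ 𝔽ᵐ (T 0) ℕ.+ ∑ (L.upTo (suc q)) (λ μ → ∑ 𝔽ᵐ (T (suc μ)))
    ≡⟨ cong₂ ℕ._+_ T₀≡0 (∑-congᴬ (L.upTo (suc q)) (Multiplicity.all (upTo-enumerates (suc q))) (λ μ μ<p-1 → T≡B (suc μ) (s≤s z≤n) (s≤s μ<p-1))) ⟩
      ∑ (L.upTo (suc q)) (λ _ → B)
    ≡⟨ trans (∑-const (L.upTo (suc q)) B) (cong (ℕ._* B) (LP.length-upTo (suc q))) ⟩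
      (p ∸ 1) ℕ.* B ∎
    where
    open ≡-Reasoning
    open VecMultiplicity using (∑-reindex)
    𝔽ᵐ = vecs p m
    enum = vecs-enumerates p m
    B = ∑ 𝔽ᵐ (λ x → 𝟙 (P x ∧ normalized (select S x)))
    T : ℕ → Vec ℕ m → ℕ
    T μ x = 𝟙 (P x) ℕ.* 𝟙 (normalized (select S (scale S μ x)))
    T₀≡0 : ∑ 𝔽ᵐ (T 0) ≡ 0
    T₀≡0 = trans (∑-cong 𝔽ᵐ (λ x → trans (cong (λ ys → 𝟙 (P x) ℕ.* 𝟙 (normalized ys)) (select-scale S 0 x))
                                     (trans (cong (λ b → 𝟙 (P x) ℕ.* 𝟙 b) (normalized-0· (select S x))) (ℕP.*-zeroʳ (𝟙 (P x))))))
                 (∑-zero 𝔽ᵐ)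
    T≡B : ∀ μ → 0 < μ → μ < p → ∑ 𝔽ᵐ (T μ) ≡ B
    T≡B μ 0<μ μ<p = begin
        ∑ 𝔽ᵐ (T μ)
      ≡⟨ ∑-cong 𝔽ᵐ (λ x → cong (λ b → 𝟙 b ℕ.* 𝟙 (normalized (select S (scale S μ x)))) (sym (P-invariant μ x 0<μ μ<p))) ⟩
        ∑ 𝔽ᵐ (λ x → 𝟙 (P (scale S μ x)) ℕ.* 𝟙 (normalized (select S (scale S μ x))))
      ≡⟨ ∑-reindex enum (scale S μ) (scale S (μ ⁻¹)) (λ _ → scale-< S μ) (λ _ → scale-< S (μ ⁻¹))
           (λ _ x<p → scale-cancel S μ (μ ⁻¹) x<p (⁻¹-inverseˡ 0<μ μ<p))
           (λ _ x<p → scale-cancel S (μ ⁻¹) μ x<p (⁻¹-inverseʳ 0<μ μ<p))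
           (λ x → 𝟙 (P x) ℕ.* 𝟙 (normalized (select S x))) ⟩
        ∑ 𝔽ᵐ (λ x → 𝟙 (P x) ℕ.* 𝟙 (normalized (select S x)))
      ≡⟨ ∑-cong 𝔽ᵐ (λ x → sym (𝟙-∧ (P x) _)) ⟩
        B ∎

  monoVal-scale : ∀ {m} (S : Fin m → Bool) μ (x e : Vec ℕ m) → + monoVal (scale S μ x) e ≋ (+ μ) ℤ.^ ideg S e ℤ.* + monoVal x e
  monoVal-scale S μ V.[]       V.[]         = ≋-refl
  monoVal-scale S μ (a V.∷ x) (e₀ V.∷ e) with S zero
  ... | true  = begin
      + ((μ ·ₚ a) ^ e₀ ℕ.* M′)                        ≡⟨ trans (ℤP.pos-* ((μ ·ₚ a) ^ e₀) M′) (cong (ℤ._* + M′) (+-^ (μ ·ₚ a) e₀)) ⟩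
      (+ (μ ·ₚ a)) ℤ.^ e₀ ℤ.* + M′                    ≈⟨ ≋-* (≋-^ e₀ (·ₚ-≋ μ a)) (monoVal-scale (S ∘ suc) μ x e) ⟩
      (+ μ ℤ.* + a) ℤ.^ e₀ ℤ.* (μ^ i ℤ.* + M)          ≡⟨ cong (ℤ._* (μ^ i ℤ.* + M)) (*-^ (+ μ) (+ a) e₀) ⟩
      μ^ e₀ ℤ.* (+ a) ℤ.^ e₀ ℤ.* (μ^ i ℤ.* + M)        ≡⟨ ℤ*.interchange (μ^ e₀) ((+ a) ℤ.^ e₀) (μ^ i) (+ M) ⟩
      μ^ e₀ ℤ.* μ^ i ℤ.* ((+ a) ℤ.^ e₀ ℤ.* + M)        ≡⟨ cong₂ ℤ._*_ (sym (ℤP.^-distribˡ-+-* (+ μ) e₀ i)) (trans (cong (ℤ._* + M) (sym (+-^ a e₀))) (sym (ℤP.pos-* (a ^ e₀) M))) ⟩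
      μ^ (e₀ ℕ.+ i) ℤ.* + (a ^ e₀ ℕ.* M)               ∎
    where
    open ≋-Reasoning
    μ^ = (+ μ) ℤ.^_
    i  = ideg (S ∘ suc) e
    M  = monoVal x e
    M′ = monoVal (scale (S ∘ suc) μ x) e
  ... | false = begin
      + (a ^ e₀ ℕ.* M′)                  ≡⟨ ℤP.pos-* (a ^ e₀) M′ ⟩
      + (a ^ e₀) ℤ.* + M′                ≈⟨ ≋-* (≋-refl {+ (a ^ e₀)}) (monoVal-scale (S ∘ suc) μ x e) ⟩
      + (a ^ e₀) ℤ.* (μ^ i ℤ.* + M)      ≡⟨ ℤ*.x∙yz≈y∙xz (+ (a ^ e₀)) (μ^ i) (+ M) ⟩
      μ^ i ℤ.* (+ (a ^ e₀) ℤ.* + M)      ≡⟨ cong (μ^ i ℤ.*_) (sym (ℤP.pos-* (a ^ e₀) M)) ⟩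
      μ^ i ℤ.* + (a ^ e₀ ℕ.* M)          ∎
    where
    open ≋-Reasoning
    μ^ = (+ μ) ℤ.^_
    i  = ideg (S ∘ suc) e
    M  = monoVal x e
    M′ = monoVal (scale (S ∘ suc) μ x) e

  evalOn-scale : ∀ {m} (c : Coeffs m) (S : Fin m → Bool) μ w (es : List (Vec ℕ m)) (x : Vec ℕ m) →
                 All (λ e → ideg S e ≡ w) es → evalOn c es (scale S μ x) ≋ (+ μ) ℤ.^ w ℤ.* evalOn c es x
  evalOn-scale c S μ w []       x []             = ≋-reflexive (sym (ℤP.*-zeroʳ ((+ μ) ℤ.^ w)))
  evalOn-scale c S μ w (e ∷ es) x (deg≡w ∷ degs) = begin
      c e ℤ.* + monoVal (scale S μ x) e ℤ.+ evalOn c es (scale S μ x)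
    ≈⟨ ≋-+ (≋-* (≋-refl {c e}) (monoVal-scale S μ x e)) (evalOn-scale c S μ w es x degs) ⟩
      c e ℤ.* ((+ μ) ℤ.^ ideg S e ℤ.* + monoVal x e) ℤ.+ (+ μ) ℤ.^ w ℤ.* evalOn c es x
    ≡⟨ cong (λ i → c e ℤ.* ((+ μ) ℤ.^ i ℤ.* + monoVal x e) ℤ.+ (+ μ) ℤ.^ w ℤ.* evalOn c es x) deg≡w ⟩
      c e ℤ.* ((+ μ) ℤ.^ w ℤ.* + monoVal x e) ℤ.+ (+ μ) ℤ.^ w ℤ.* evalOn c es x
    ≡⟨ solve 4 (λ c u m f → c :* (u :* m) :+ u :* f := u :* (c :* m :+ f)) refl (c e) ((+ μ) ℤ.^ w) (+ monoVal x e) (evalOn c es x) ⟩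
      (+ μ) ℤ.^ w ℤ.* (c e ℤ.* + monoVal x e ℤ.+ evalOn c es x) ∎
    where open ≋-Reasoning

  p∤^ : ∀ {μ} w → 0 < μ → μ < p → ¬ + p ℤD.∣ (+ μ) ℤ.^ w
  p∤^ zero    0<μ μ<p p∣1 = p∤ (s≤s z≤n) (s≤s (s≤s z≤n)) (ℤD.∣⇒∣ᵤ p∣1)
  p∤^ {μ} (suc w) 0<μ μ<p p∣μ^[1+w] with euclidsLemmaℤ (+ μ) ((+ μ) ℤ.^ w) p∣μ^[1+w]
  ... | inj₁ p∣μ   = p∤ 0<μ μ<p (ℤD.∣⇒∣ᵤ p∣μ)
  ... | inj₂ p∣μ^w = p∤^ w 0<μ μ<p p∣μ^w

  divisibleBy-unit : ∀ {v′ u v} → v′ ≋ u ℤ.* v → ¬ + p ℤD.∣ u → divisibleBy p v′ ≡ divisibleBy p v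
  divisibleBy-unit {v′} {u} {v} v′≋uv p∤u = divisibleBy-⇔ p {v′} {v} to from
    where
    to : p ∣ ∣ v′ ∣ → p ∣ ∣ v ∣
    to p∣v′ with euclidsLemmaℤ u v (≋0⇒∣ (≋-trans (≋-sym v′≋uv) (∣⇒≋0 (ℤD.∣ᵤ⇒∣ p∣v′))))
    ... | inj₁ p∣u = ⊥-elim (p∤u p∣u)
    ... | inj₂ p∣v = ℤD.∣⇒∣ᵤ p∣v
    from : p ∣ ∣ v ∣ → p ∣ ∣ v′ ∣
    from p∣v = ℤD.∣⇒∣ᵤ (≋0⇒∣ (≋-trans v′≋uv (≋-trans (≋-* (≋-refl {u}) (∣⇒≋0 (ℤD.∣ᵤ⇒∣ p∣v))) (≋-reflexive (ℤP.*-zeroʳ u)))))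

  divisibleBy-0 : divisibleBy p (+ 0) ≡ true
  divisibleBy-0 = trans (isYes≗does (p ∣? 0)) (dec-true (p ∣? 0) (p ℕD.∣0))

  divisibleBy-scale : ∀ {m} (c : Coeffs m) (S : Fin m → Bool) {μ} w (es : List (Vec ℕ m)) (x : Vec ℕ m) →
                      All (λ e → ideg S e ≡ w) es → 0 < μ → μ < p →
                      divisibleBy p (evalOn c es (scale S μ x)) ≡ divisibleBy p (evalOn c es x)
  divisibleBy-scale c S {μ} w es x degs 0<μ μ<p = divisibleBy-unit (evalOn-scale c S μ w es x degs) (p∤^ w 0<μ μ<p)

  private
    ∑-column-zero : ∀ b → ∑ (L.upTo p) (λ t → 𝟙 (isZero (if b then t ∷ [] else []))) ≡ p ^ 𝟙 (not b)
    ∑-column-zero true  = cong suc (trans (cong (λ ts → ∑ ts (λ t → 𝟙 ((t ℕ.≡ᵇ 0) ∧ true))) (sym (LP.map-upTo suc (suc q))))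
                                   (trans (∑-map ℕ.suc (L.upTo (suc q)) (λ t → 𝟙 ((t ℕ.≡ᵇ 0) ∧ true))) (∑-zero (L.upTo (suc q)))))
    ∑-column-zero false = trans (∑-const (L.upTo p) 1) (cong (ℕ._* 1) (LP.length-upTo p))

  count-select-zero : ∀ {m} (T : Fin m → Bool) → ∑ (vecs p m) (λ x → 𝟙 (isZero (select T x))) ≡ p ^ card (not ∘ T)
  count-select-zero {zero}  T = refl
  count-select-zero {suc m} T = begin
      ∑ (vecs p (suc m)) (λ x → 𝟙 (isZero (select T x)))
    ≡⟨ ∑-vecs-suc p m _ ⟩
      ∑ (L.upTo p) (λ t → ∑ (vecs p m) (λ x → 𝟙 (isZero (select T (t V.∷ x)))))
    ≡⟨ ∑-cong (L.upTo p) (λ t → trans (∑-cong (vecs p m) (split t)) (∑-*ˡ (Z t) (vecs p m) _)) ⟩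
      ∑ (L.upTo p) (λ t → Z t ℕ.* ∑ (vecs p m) (λ x → 𝟙 (isZero (select (T ∘ suc) x))))
    ≡⟨ ∑-*ʳ _ (L.upTo p) Z ⟩
      ∑ (L.upTo p) Z ℕ.* ∑ (vecs p m) (λ x → 𝟙 (isZero (select (T ∘ suc) x)))
    ≡⟨ cong₂ ℕ._*_ (∑-column-zero (T zero)) (count-select-zero (T ∘ suc)) ⟩
      p ^ 𝟙 (not (T zero)) ℕ.* p ^ card (not ∘ T ∘ suc)
    ≡⟨ ℕP.^-distribˡ-+-* p (𝟙 (not (T zero))) _ ⟨
      p ^ (𝟙 (not (T zero)) ℕ.+ card (not ∘ T ∘ suc))
    ≡⟨ cong (p ^_) (card-suc (not ∘ T)) ⟨
      p ^ card (not ∘ T) ∎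
    where
    open ≡-Reasoning
    Z : ℕ → ℕ
    Z t = 𝟙 (isZero (if T zero then t ∷ [] else []))
    split : ∀ t x → 𝟙 (isZero (select T (t V.∷ x))) ≡ Z t ℕ.* 𝟙 (isZero (select (T ∘ suc) x))
    split t x = trans (cong (𝟙 ∘ isZero) (select-∷ T t x)) (trans (cong 𝟙 (isZero-++ (if T zero then t ∷ [] else []) (select (T ∘ suc) x))) (𝟙-∧ (isZero (if T zero then t ∷ [] else [])) (isZero (select (T ∘ suc) x))))

  ∑-at-origin : ∀ {m} (G : Vec ℕ m → ℕ) → ∑ (vecs p m) (λ x → 𝟙 (isZero (V.toList x)) ℕ.* G x) ≡ G 0ᵛ
  ∑-at-origin {m} G = trans (∑-cong (vecs p m) (λ x → cong (ℕ._* G x) (𝟙-isZero≡δ0ᵛ x)))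
                            (VecMultiplicity.∑-pick (vecs-enumerates p m) 0ᵛ G 0ᵛ<p)
    where
    0ᵛ<p : ∀ {m} → VAll.All (_< p) (0ᵛ {m})
    0ᵛ<p {zero}  = VAll.[]
    0ᵛ<p {suc m} = s≤s z≤n VAll.∷ 0ᵛ<p

  -- Point counts of V and L(V,k)
  module PointCounts {n k : ℕ} (f : Coeffs (suc n)) (I : Fin (suc n) → Bool) (2≤k : 2 ≤ k) (k≤n : k ≤ n)
                     (card-I : card I ≡ k) (f∈I^k : InIdealPower (suc n) I k f) where

    d D : ℕ
    d = suc n
    D = n ∸ k

    J : Fin d → Bool
    J = not ∘ I

    Mon Monₖ : List (Vec ℕ d)
    Mon  = monomials d d
    Monₖ = L.filter (λ e → ideg I e ℕ.≟ k) Mon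

    F G : Vec ℕ d → ℤ
    F = evalForm d f
    G = evalExc d k I f

    d∸k≡1+D : d ∸ k ≡ suc D
    d∸k≡1+D = ℕP.+-∸-assoc 1 k≤n

    card-J : card J ≡ suc D
    card-J = trans (sym (ℕP.m+n∸m≡n (card I) (card J))) (trans (cong₂ _∸_ (card-compl I) card-I) d∸k≡1+D)

    Mon-degree : All (λ e → V.sum e ≡ d) Mon
    Mon-degree = AllP.all-filter (λ e → V.sum e ℕ.≟ d) (vecs (suc d) d)

    Monₖ-degree : All (λ e → V.sum e ≡ d) Monₖ
    Monₖ-degree = AllP.filter⁺ (λ e → ideg I e ℕ.≟ k) Mon-degree

    Monₖ-I-degree : All (λ e → ideg I e ≡ k) Monₖ
    Monₖ-I-degree = AllP.all-filter (λ e → ideg I e ℕ.≟ k) Mon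

    J-degree : ∀ e → V.sum e ≡ d → ideg J e ≡ d ∸ ideg I e
    J-degree e |e|≡d = trans (sym (ℕP.m+n∸m≡n (ideg I e) (ideg J e))) (cong (_∸ ideg I e) (trans (ideg-compl I e) |e|≡d))

    Monₖ-J-degree : All (λ e → ideg J e ≡ suc D) Monₖ
    Monₖ-J-degree = All.zipWith (λ {e} (|e|≡d , I-deg≡k) → trans (J-degree e |e|≡d) (trans (cong (d ∸_) I-deg≡k) d∸k≡1+D))
                                 (Monₖ-degree , Monₖ-I-degree)

    -- Monomials of I-degree < k do not occur in f, so every term of f has J-degree ≤ d - k.
    term-Poly : ∀ e → V.sum e ≡ d → ∀ B → (k ≤ ideg I e → ideg J e ≤ B) → Poly J B (λ x → f e ℤ.* + monoVal x e)
    term-Poly e |e|≡d B J-bound with ideg I e ℕP.<? k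
    ... | yes I-deg<k = castᴾ zeroᴾ (λ x → cong (ℤ._* + monoVal x e) (f∈I^k e |e|≡d I-deg<k))
    ... | no  I-deg≮k = monoᴾ (f e) e (J-bound (ℕP.≮⇒≥ I-deg≮k))

    evalOn-Poly : ∀ es → All (λ e → V.sum e ≡ d) es → Poly J (suc D) (evalOn f es)
    evalOn-Poly []       []                = zeroᴾ
    evalOn-Poly (e ∷ es) (|e|≡d ∷ degrees) = term-Poly e |e|≡d (suc D) J-bound +ᴾ evalOn-Poly es degrees
      where
      J-bound : k ≤ ideg I e → ideg J e ≤ suc D
      J-bound k≤ = subst (ideg J e ≤_) d∸k≡1+D (subst (_≤ d ∸ k) (sym (J-degree e |e|≡d)) (ℕP.∸-monoʳ-≤ d k≤))

    -- f - f_k consists of the terms of I-degree > k.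
    evalOn-residual-Poly : ∀ es → All (λ e → V.sum e ≡ d) es →
                           Poly J D (λ x → evalOn f es x ℤ.- evalOn f (L.filter (λ e → ideg I e ℕ.≟ k) es) x)
    evalOn-residual-Poly []       []                = castᴾ zeroᴾ (λ x → refl)
    evalOn-residual-Poly (e ∷ es) (|e|≡d ∷ degrees) with ideg I e ℕ.≟ k
    ... | yes I-deg≡k rewrite LP.filter-accept (λ e → ideg I e ℕ.≟ k) {e} {es} I-deg≡k = castᴾ (evalOn-residual-Poly es degrees)
      (λ x → solve 3 (λ t u v → t :+ u :- (t :+ v) := u :- v) refl (f e ℤ.* + monoVal x e) _ _)
    ... | no  I-deg≢k rewrite LP.filter-reject (λ e → ideg I e ℕ.≟ k) {e} {es} I-deg≢k = castᴾ (term-Poly e |e|≡d D J-bound +ᴾ evalOn-residual-Poly es degrees)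
      (λ x → solve 3 (λ t u v → t :+ u :- v := t :+ (u :- v)) refl (f e ℤ.* + monoVal x e) _ _)
      where
      J-bound : k ≤ ideg I e → ideg J e ≤ D
      J-bound k≤ = subst (_≤ D) (sym (J-degree e |e|≡d)) (ℕP.∸-monoʳ-≤ d (ℕP.≤∧≢⇒< k≤ (I-deg≢k ∘ sym)))

    affineCount-F≋G : + affineCount F ≋ + affineCount G
    affineCount-F≋G = begin
        + affineCount F                                    ≈⟨ affineCount≋ n F ⟩
        ℤ.- ℤ∑.∑ (vecs p d) (λ x → F x ℤ.^ (p ∸ 1))        ≈⟨ ≋-neg (chevalley-warning card-J (evalOn-Poly Mon Mon-degree) (evalOn-Poly Monₖ Monₖ-degree) (evalOn-residual-Poly Mon Mon-degree)) ⟩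
        ℤ.- ℤ∑.∑ (vecs p d) (λ x → G x ℤ.^ (p ∸ 1))        ≈⟨ ≋-sym (affineCount≋ n G) ⟩
        + affineCount G                                    ∎
      where open ≋-Reasoning

    private
      𝔽ᵈ : List (Vec ℕ d)
      𝔽ᵈ = vecs p d

      Pf Pg : Vec ℕ d → Bool
      Pf x = divisibleBy p (F x)
      Pg x = divisibleBy p (G x)

      all : Fin d → Bool
      all _ = true

    -- Besides the origin, the affine cone over V consists of the (p - 1)-fold multiples of its normalized points.
    affineCount-F : affineCount F ≡ 1 ℕ.+ (p ∸ 1) ℕ.* countHyp n d f p
    affineCount-F = begin
        affineCount F
      ≡⟨ ∑-𝟙-split 𝔽ᵈ Pf (λ x → isZero (select all x)) ⟩
        ∑ 𝔽ᵈ (λ x → 𝟙 (Pf x ∧ isZero (select all x))) ℕ.+ ∑ 𝔽ᵈ (λ x → 𝟙 (Pf x ∧ not (isZero (select all x))))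
      ≡⟨ cong₂ ℕ._+_ origin (count-orbits all Pf (λ μ x → divisibleBy-scale f all d Mon x all-degree)) ⟩
        1 ℕ.+ (p ∸ 1) ℕ.* ∑ 𝔽ᵈ (λ x → 𝟙 (Pf x ∧ normalized (select all x)))
      ≡⟨ cong (λ c → 1 ℕ.+ (p ∸ 1) ℕ.* c) (trans (∑-cong 𝔽ᵈ (λ x → cong 𝟙 (trans (BP.∧-comm (Pf x) _) (cong (λ ys → normalized ys ∧ Pf x) (select-all x)))))
                                                 (sym (count≡∑𝟙 _ 𝔽ᵈ))) ⟩
        1 ℕ.+ (p ∸ 1) ℕ.* countHyp n d f p ∎
      where
      open ≡-Reasoning
      all-degree : All (λ e → ideg all e ≡ d) Mon
      all-degree = All.map (λ {e} |e|≡d → trans (ideg-all e) |e|≡d) Mon-degree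
      F[0]≡0 : F 0ᵛ ≡ + 0
      F[0]≡0 = evalOn-vanish f all Mon 0ᵛ (All.map (λ {e} |e|≡d → subst (1 ≤_) (sym (trans (ideg-all e) |e|≡d)) (s≤s z≤n)) Mon-degree)
                             (trans (cong isZero (select-all (0ᵛ {d}))) (isZero-0ᵛ {d}))
      origin : ∑ 𝔽ᵈ (λ x → 𝟙 (Pf x ∧ isZero (select all x))) ≡ 1
      origin = begin
          ∑ 𝔽ᵈ (λ x → 𝟙 (Pf x ∧ isZero (select all x)))
        ≡⟨ ∑-cong 𝔽ᵈ (λ x → trans (cong 𝟙 (trans (BP.∧-comm (Pf x) _) (cong (λ ys → isZero ys ∧ Pf x) (select-all x)))) (𝟙-∧ _ (Pf x))) ⟩
          ∑ 𝔽ᵈ (λ x → 𝟙 (isZero (V.toList x)) ℕ.* 𝟙 (Pf x))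
        ≡⟨ ∑-at-origin (𝟙 ∘ Pf) ⟩
          𝟙 (Pf 0ᵛ)
        ≡⟨ cong (𝟙 ∘ divisibleBy p) F[0]≡0 ⟩
          𝟙 (divisibleBy p (+ 0))
        ≡⟨ cong 𝟙 divisibleBy-0 ⟩
          1 ∎

    private
      zero-on : (Fin d → Bool) → Vec ℕ d → Bool
      zero-on T x = isZero (select T x)

      G-vanish : ∀ T → All (λ e → 1 ≤ ideg T e) Monₖ → ∀ x → zero-on T x ≡ true → Pg x ≡ true
      G-vanish T degrees x x_T≡0 = trans (cong (divisibleBy p) (evalOn-vanish f T Monₖ x degrees x_T≡0)) divisibleBy-0

      Pg-on-I=0 : ∀ x → zero-on I x ≡ true → Pg x ≡ true
      Pg-on-I=0 = G-vanish I (All.map (λ {e} I-deg≡k → subst (1 ≤_) (sym I-deg≡k) (ℕP.≤-trans (s≤s z≤n) 2≤k)) Monₖ-I-degree)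

      Pg-on-J=0 : ∀ x → zero-on J x ≡ true → Pg x ≡ true
      Pg-on-J=0 = G-vanish J (All.map (λ {e} J-deg≡1+D → subst (1 ≤_) (sym J-deg≡1+D) (s≤s z≤n)) Monₖ-J-degree)

      J⇒¬I : ∀ i → J i ≡ true → I i ≡ false
      J⇒¬I i Ji≡true = trans (sym (BP.not-involutive (I i))) (cong not Ji≡true)

      I⇒¬J : ∀ i → I i ≡ true → J i ≡ false
      I⇒¬J i Ii≡true = cong not Ii≡true

      X : ℕ
      X = ∑ 𝔽ᵈ (λ x → 𝟙 (not (zero-on I x) ∧ zero-on J x))

    -- Split the cone over L(V,k) by whether x_I or x_J vanishes; where neither does, the units act freely on both blocks.
    affineCount-G : affineCount G ≡ p ^ suc D ℕ.+ (X ℕ.+ (p ∸ 1) ℕ.* ((p ∸ 1) ℕ.* countExc n d k I f p))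
    affineCount-G = begin
        affineCount G
      ≡⟨ ∑-𝟙-split 𝔽ᵈ Pg (zero-on I) ⟩
        ∑ 𝔽ᵈ (λ x → 𝟙 (Pg x ∧ zero-on I x)) ℕ.+ ∑ 𝔽ᵈ (𝟙 ∘ P₁)
      ≡⟨ cong₂ ℕ._+_ (∑-cong 𝔽ᵈ (λ x → 𝟙-∧-implied (Pg x) (zero-on I x) (Pg-on-I=0 x))) (∑-𝟙-split 𝔽ᵈ P₁ (zero-on J)) ⟩
        ∑ 𝔽ᵈ (𝟙 ∘ zero-on I) ℕ.+ (∑ 𝔽ᵈ (λ x → 𝟙 (P₁ x ∧ zero-on J x)) ℕ.+ ∑ 𝔽ᵈ (λ x → 𝟙 (P₁ x ∧ not (zero-on J x))))
      ≡⟨ cong₂ ℕ._+_ (trans (count-select-zero I) (cong (p ^_) card-J))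
                     (cong₂ ℕ._+_ (∑-cong 𝔽ᵈ (λ x → trans (cong 𝟙 (BP.∧-assoc (Pg x) _ _)) (𝟙-∧-implied (Pg x) _ (Pg-on-J=0 x ∘ ∧-true-right))))
                                   (count-orbits J P₁ P₁-scale-J)) ⟩
        p ^ suc D ℕ.+ (X ℕ.+ (p ∸ 1) ℕ.* ∑ 𝔽ᵈ (λ x → 𝟙 (P₁ x ∧ normalized (select J x))))
      ≡⟨ cong (λ c → p ^ suc D ℕ.+ (X ℕ.+ (p ∸ 1) ℕ.* c))
              (trans (∑-cong 𝔽ᵈ (λ x → cong 𝟙 (∧.xy∙z≈xz∙y (Pg x) (not (zero-on I x)) _))) (count-orbits I P₂ P₂-scale-I)) ⟩
        p ^ suc D ℕ.+ (X ℕ.+ (p ∸ 1) ℕ.* ((p ∸ 1) ℕ.* ∑ 𝔽ᵈ (λ x → 𝟙 (P₂ x ∧ normalized (select I x)))))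
      ≡⟨ cong (λ c → p ^ suc D ℕ.+ (X ℕ.+ (p ∸ 1) ℕ.* ((p ∸ 1) ℕ.* c)))
              (trans (∑-cong 𝔽ᵈ (λ x → cong 𝟙 (∧.xy∙z≈z∙yx (Pg x) _ _))) (sym (count≡∑𝟙 _ 𝔽ᵈ))) ⟩
        p ^ suc D ℕ.+ (X ℕ.+ (p ∸ 1) ℕ.* ((p ∸ 1) ℕ.* countExc n d k I f p)) ∎
      where
      open ≡-Reasoning
      P₁ P₂ : Vec ℕ d → Bool
      P₁ x = Pg x ∧ not (zero-on I x)
      P₂ x = Pg x ∧ normalized (select J x)
      ∧-true-right : ∀ {a b} → a ∧ b ≡ true → b ≡ true
      ∧-true-right {true} b≡true = b≡true
      P₁-scale-J : ∀ μ x → 0 < μ → μ < p → P₁ (scale J μ x) ≡ P₁ x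
      P₁-scale-J μ x 0<μ μ<p = cong₂ (λ b ys → b ∧ not (isZero ys))
        (divisibleBy-scale f J (suc D) Monₖ x Monₖ-J-degree 0<μ μ<p) (select-scale-disjoint J I μ x J⇒¬I)
      P₂-scale-I : ∀ μ x → 0 < μ → μ < p → P₂ (scale I μ x) ≡ P₂ x
      P₂-scale-I μ x 0<μ μ<p = cong₂ (λ b ys → b ∧ normalized ys)
        (divisibleBy-scale f I k Monₖ x Monₖ-I-degree 0<μ μ<p) (select-scale-disjoint I J μ x I⇒¬J)

    1+X≡p^k : 1 ℕ.+ X ≡ p ^ k
    1+X≡p^k = begin
        1 ℕ.+ X
      ≡⟨ cong (ℕ._+ X) (sym origin) ⟩
        ∑ 𝔽ᵈ (λ x → 𝟙 (zero-on J x ∧ zero-on I x)) ℕ.+ X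
      ≡⟨ cong (∑ 𝔽ᵈ (λ x → 𝟙 (zero-on J x ∧ zero-on I x)) ℕ.+_) (∑-cong 𝔽ᵈ (λ x → cong 𝟙 (BP.∧-comm (not (zero-on I x)) (zero-on J x)))) ⟩
        ∑ 𝔽ᵈ (λ x → 𝟙 (zero-on J x ∧ zero-on I x)) ℕ.+ ∑ 𝔽ᵈ (λ x → 𝟙 (zero-on J x ∧ not (zero-on I x)))
      ≡⟨ ∑-𝟙-split 𝔽ᵈ (zero-on J) (zero-on I) ⟨
        ∑ 𝔽ᵈ (𝟙 ∘ zero-on J)
      ≡⟨ count-select-zero J ⟩
        p ^ card (not ∘ J)
      ≡⟨ cong (p ^_) card-¬J ⟩
        p ^ k ∎
      where
      open ≡-Reasoning
      origin : ∑ 𝔽ᵈ (λ x → 𝟙 (zero-on J x ∧ zero-on I x)) ≡ 1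
      origin = trans (∑-cong 𝔽ᵈ (λ x → trans (cong 𝟙 (trans (BP.∧-comm (zero-on J x) _) (isZero-select-compl I x)))
                                            (sym (ℕP.*-identityʳ (𝟙 (isZero (V.toList x)))))))
                     (∑-at-origin {d} (λ _ → 1))
      card-¬J : card (not ∘ J) ≡ k
      card-¬J = ℕP.+-cancelʳ-≡ (suc D) _ _ (begin
          card (not ∘ J) ℕ.+ suc D       ≡⟨ cong (card (not ∘ J) ℕ.+_) card-J ⟨
          card (not ∘ J) ℕ.+ card J      ≡⟨ ℕP.+-comm (card (not ∘ J)) _ ⟩
          card J ℕ.+ card (not ∘ J)      ≡⟨ card-compl J ⟩
          d                              ≡⟨ card-compl I ⟨
          card I ℕ.+ card J              ≡⟨ cong₂ ℕ._+_ card-I card-J ⟩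
          k ℕ.+ suc D                    ∎)

    prime-similar-mod-p : + p ℤD.∣ ((+ countExc n d k I f p ℤ.- + 1) ℤ.- signDiff (n ∸ 1) (n ∸ 2) ℤ.* (+ countHyp n d f p ℤ.- + 1))
    prime-similar-mod-p = ≋0⇒∣ (begin
        (+ Lₚ ℤ.- + 1) ℤ.- signDiff (n ∸ 1) (n ∸ 2) ℤ.* (+ Vₚ ℤ.- + 1)
      ≡⟨ cong (λ s → (+ Lₚ ℤ.- + 1) ℤ.- s ℤ.* (+ Vₚ ℤ.- + 1)) (signDiff≡-1 (n ∸ 1) (n ∸ 2)) ⟩
        (+ Lₚ ℤ.- + 1) ℤ.- −1 ℤ.* (+ Vₚ ℤ.- + 1)
      ≡⟨ solve 2 (λ L V → (L :- con (+ 1)) :- con −1 :* (V :- con (+ 1))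
                   := (con (+ 0) :+ (con −1 :+ con −1 :* (con −1 :* L))) :- (con (+ 1) :+ con −1 :* V)) refl (+ Lₚ) (+ Vₚ) ⟩
        (+ 0 ℤ.+ (−1 ℤ.+ −1 ℤ.* (−1 ℤ.* + Lₚ))) ℤ.- (+ 1 ℤ.+ −1 ℤ.* + Vₚ)
      ≈⟨ ≋-− (≋-sym affineCount-G≋) (≋-sym affineCount-F≋) ⟩
        + affineCount G ℤ.- + affineCount F
      ≈⟨ ≋-− (≋-sym affineCount-F≋G) (≋-refl {+ affineCount F}) ⟩
        + affineCount F ℤ.- + affineCount F
      ≡⟨ ℤP.+-inverseʳ (+ affineCount F) ⟩
        + 0 ∎)
      where
      open ≋-Reasoning
      Lₚ = countExc n d k I f p
      Vₚ = countHyp n d f p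
      −1 : ℤ
      −1 = ℤ.- + 1
      ≋−1 : ∀ {a} → + 1 ℤ.+ a ≋ + 0 → a ≋ −1
      ≋−1 {a} 1+a≋0 = ≋-trans (≋-reflexive (solve 1 (λ a → a := con (+ 1) :+ a :- con (+ 1)) refl a)) (≋-− 1+a≋0 (≋-refl {+ 1}))
      p∸1≋−1 : + (p ∸ 1) ≋ −1
      p∸1≋−1 = ≋−1 (∣ℕ⇒≋0 ℕD.∣-refl)
      p^≋0 : ∀ c → + (p ^ suc c) ≋ + 0
      p^≋0 c = ∣ℕ⇒≋0 (ℕD.∣m⇒∣m*n (p ^ c) ℕD.∣-refl)
      X≋−1 : + X ≋ −1
      X≋−1 = ≋−1 (≋-trans (≋-reflexive (trans (sym (ℤP.pos-+ 1 X)) (cong +_ 1+X≡p^k))) (subst (λ c → + (p ^ c) ≋ + 0) (ℕP.suc-pred k {{k≢0}}) (p^≋0 (ℕ.pred k))))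
        where k≢0 = ℕ.>-nonZero (ℕP.<-≤-trans (s≤s z≤n) 2≤k)
      affineCount-F≋ : + affineCount F ≋ + 1 ℤ.+ −1 ℤ.* + Vₚ
      affineCount-F≋ = begin
          + affineCount F                          ≡⟨ cong +_ affineCount-F ⟩
          + (1 ℕ.+ (p ∸ 1) ℕ.* Vₚ)                 ≡⟨ trans (ℤP.pos-+ 1 _) (cong (ℤ._+_ (+ 1)) (ℤP.pos-* (p ∸ 1) Vₚ)) ⟩
          + 1 ℤ.+ + (p ∸ 1) ℤ.* + Vₚ               ≈⟨ ≋-+ (≋-refl {+ 1}) (≋-* p∸1≋−1 (≋-refl {+ Vₚ})) ⟩
          + 1 ℤ.+ −1 ℤ.* + Vₚ                      ∎
      affineCount-G≋ : + affineCount G ≋ + 0 ℤ.+ (−1 ℤ.+ −1 ℤ.* (−1 ℤ.* + Lₚ))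
      affineCount-G≋ = begin
          + affineCount G
        ≡⟨ cong +_ affineCount-G ⟩
          + (p ^ suc D ℕ.+ (X ℕ.+ (p ∸ 1) ℕ.* ((p ∸ 1) ℕ.* Lₚ)))
        ≡⟨ trans (ℤP.pos-+ (p ^ suc D) _) (cong (ℤ._+_ (+ (p ^ suc D))) (trans (ℤP.pos-+ X _) (cong (ℤ._+_ (+ X))
             (trans (ℤP.pos-* (p ∸ 1) _) (cong (ℤ._*_ (+ (p ∸ 1))) (ℤP.pos-* (p ∸ 1) Lₚ)))))) ⟩
          + (p ^ suc D) ℤ.+ (+ X ℤ.+ + (p ∸ 1) ℤ.* (+ (p ∸ 1) ℤ.* + Lₚ))
        ≈⟨ ≋-+ (p^≋0 D) (≋-+ X≋−1 (≋-* p∸1≋−1 (≋-* p∸1≋−1 (≋-refl {+ Lₚ})))) ⟩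
          + 0 ℤ.+ (−1 ℤ.+ −1 ℤ.* (−1 ℤ.* + Lₚ)) ∎

proposition3p11 : (n k : ℕ) (f : Coeffs (suc n)) (I : Fin (suc n) → Bool) →
    2 ≤ k → k ≤ n → card I ≡ k →
    NonzeroForm (suc n) f →
    InIdealPower (suc n) I k f →
    PrimeSimilar (n ∸ 2) (countExc n (suc n) k I f) (n ∸ 1) (countHyp n (suc n) f)
-- The congruence holds at every prime and for every f ∈ (x_I)^k.
proposition3p11 n k f I 2≤k k≤n card-I _ f∈I^k = 0 , λ where
  (suc (suc q)) p-prime _ → ℤD.∣⇒∣ᵤ (PointCounts.prime-similar-mod-p p-prime f I 2≤k k≤n card-I f∈I^k)
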